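{- Let $G$ be a connected $k$-regular graph of order $n$ and diameter $2$ with adjacency eigenvalues $k=\lambda_1\ge\lambda_2\ge\cdots\ge\lambda_n$. Then the distance Seidel eigenvalues of the extended double cover $EDC(G)$ are $-8n+4k+7$ and $2n-4k-1$ (each once), together with $7+4\lambda_r$ and $-1-4\lambda_r$ for $r=2,\dots,n$.
   Context: For a connected graph with distance matrix $\mathcal{D}$, the distance Seidel matrix is $\mathcal{D}^S=J-I-2\mathcal{D}$ ($J$ all-ones); its eigenvalues are the distance Seidel eigenvalues. For $G$ with $V(G)=\{v_1,\dots,v_n\}$, the extended double cover $EDC(G)$ is the bipartite graph with vertex set $\{v_1,\dots,v_n,u_1,\dots,u_n\}$ in which $v_r$ is adjacent to $u_r$ for each $r$, and $v_r$ is adjacent to $u_t$ whenever $v_r$ is adjacent to $v_t$ in $G$ (no other edges). -}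

module Defs where

open import Data.Nat as ℕ using (ℕ; zero; suc)
open import Data.Integer as ℤ using (ℤ; +_; -_; _-_)
open import Data.Fin as Fin using (Fin; zero; suc; punchIn; splitAt; _≟_)
open import Data.Bool using (Bool; true; false; _∧_; _∨_; if_then_else_)
open import Data.Sum using (_⊎_; inj₁; inj₂)
open import Data.Product using (_×_; ∃-syntax)
open import Relation.Nullary.Decidable using (⌊_⌋)
open import Relation.Binary.PropositionalEquality using (_≡_)

Graph : ℕ → Set
Graph n = Fin n → Fin n → Bool

IsSimple : ∀ {n} → Graph n → Set
IsSimple {n} G = (∀ (u v : Fin n) → G u v ≡ G v u) × (∀ (u : Fin n) → G u u ≡ false)

sumℕ : ∀ m → (Fin m → ℕ) → ℕ
sumℕ zero    f = 0
sumℕ (suc m) f = f zero ℕ.+ sumℕ m (λ i → f (suc i))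

sumℤ : ∀ m → (Fin m → ℤ) → ℤ
sumℤ zero    f = + 0
sumℤ (suc m) f = f zero ℤ.+ sumℤ m (λ i → f (suc i))

anyFin : ∀ m → (Fin m → Bool) → Bool
anyFin zero    f = false
anyFin (suc m) f = f zero ∨ anyFin m (λ i → f (suc i))

degree : ∀ {n} → Graph n → Fin n → ℕ
degree {n} G u = sumℕ n (λ w → if G u w then 1 else 0)

Regular : ∀ {n} → Graph n → ℕ → Set
Regular {n} G k = ∀ (u : Fin n) → degree G u ≡ k

Reach : ∀ {n} → Graph n → ℕ → Fin n → Fin n → Bool
Reach G zero    u v = ⌊ u ≟ v ⌋
Reach {n} G (suc d) u v = Reach G d u v ∨ anyFin n (λ w → G u w ∧ Reach G d w v)

Connected : ∀ {n} → Graph n → Set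
Connected {n} G = ∀ (u v : Fin n) → ∃[ d ] (Reach G d u v ≡ true)

-- Graph distance: the least d with a walk of length ≤ d, computed as the number
-- of d ∈ {0,…,n-1} with no such walk (Reach is monotone in d, and in a connected
-- graph on n vertices every distance is ≤ n-1, so this is exactly the distance).
dist : ∀ {n} → Graph n → Fin n → Fin n → ℕ
dist {n} G u v = sumℕ n (λ d → if Reach G (Fin.toℕ d) u v then 0 else 1)

Diameter2 : ∀ {n} → Graph n → Set
Diameter2 {n} G = (∀ (u v : Fin n) → dist G u v ℕ.≤ 2) × ∃[ u ] ∃[ v ] (dist G u v ≡ 2)

Mat : ℕ → Set
Mat m = Fin m → Fin m → ℤ

δ : ∀ {m} → Fin m → Fin m → ℤ
δ i j = if ⌊ i ≟ j ⌋ then + 1 else + 0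

sign : ℕ → ℤ
sign zero          = + 1
sign (suc zero)    = - + 1
sign (suc (suc j)) = sign j

det : ∀ m → Mat m → ℤ
det zero    M = + 1
det (suc m) M = sumℤ (suc m) (λ j →
  sign (Fin.toℕ j) ℤ.* M zero j ℤ.* det m (λ r c → M (suc r) (punchIn j c)))

charPoly : ∀ {m} → Mat m → ℤ → ℤ
charPoly {m} M x = det m (λ i j → x ℤ.* δ i j - M i j)

adjMat : ∀ {n} → Graph n → Mat n
adjMat G i j = if G i j then + 1 else + 0

distMat : ∀ {n} → Graph n → Mat n
distMat G i j = + dist G i j

distSeidel : ∀ {n} → Graph n → Mat n
distSeidel G i j = (+ 1 - δ i j) - + 2 ℤ.* distMat G i j

-- Extended double cover on Fin (n + n): v_r = inj₁ r, u_r = inj₂ r.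
EDC : ∀ {n} → Graph n → Graph (n ℕ.+ n)
EDC {n} G i j with splitAt n i | splitAt n j
... | inj₁ r | inj₂ t = ⌊ r ≟ t ⌋ ∨ G r t
... | inj₂ t | inj₁ r = ⌊ r ≟ t ⌋ ∨ G r t
... | inj₁ _ | inj₁ _ = false
... | inj₂ _ | inj₂ _ = false

-- Because G has diameter 2, any two vertices on the same side of EDC(G) have a common neighbour on
-- the other side, so they are at distance 2; v_r and u_t are at distance 1 when t = r or t ~ r, and
-- at distance 3 otherwise (through u_r). Hence xI − D^S(EDC G) is the block matrix [[P, Q], [Q, P]]
-- with P = (x − 3)I + 3J and Q = 5J − 4(I + A), and column and row operations between the two halves
-- give det [[P, Q], [Q, P]] = det (P + Q) · det (P − Q). Here P + Q = xI − (7I + 4A) + 8J and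
-- P − Q = xI − (−I − 4A) − 2J. As G is k-regular, the rows of M = xI − (7I + 4A) have the constant
-- sum μ = x − 7 − 4k, and det (M + cJ) · μ = (μ + cn) · det M (the rank-one update, stated without
-- division); likewise for −I − 4A with μ = x + 1 + 4k. This trades the eigenvalues 7 + 4k and
-- −1 − 4k for −8n + 4k + 7 and 2n − 4k − 1.

module Submission where

open import Defs
open import Data.Nat as ℕ using (ℕ; zero; suc; z≤n; s≤s)
import Data.Nat.Properties as ℕP
open import Data.Integer as ℤ using (ℤ; +_; -_; _-_; _+_; _*_)
import Data.Integer.Properties as ℤP
open import Data.Integer.Tactic.RingSolver using (solve-∀)
open import Data.Fin as Fin using (Fin; zero; suc; punchIn; toℕ; fromℕ<; splitAt; _↑ˡ_; _↑ʳ_; _≟_)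
import Data.Fin.Properties as FinP
import Data.Bool.Properties as BoolP
open import Data.Bool using (Bool; true; false; _∧_; _∨_; if_then_else_)
open import Data.Sum using (_⊎_; inj₁; inj₂; map₁)
open import Data.Product using (_×_; _,_; ∃-syntax; proj₁; proj₂)
open import Data.Empty using (⊥; ⊥-elim)
open import Relation.Nullary using (Dec; yes; no; ¬_)
open import Relation.Nullary.Decidable using (⌊_⌋)
open import Relation.Binary.PropositionalEquality
open import Function using (_∘_)

sumℤ-cong : ∀ m {f g : Fin m → ℤ} → (∀ i → f i ≡ g i) → sumℤ m f ≡ sumℤ m g
sumℤ-cong zero    h = refl
sumℤ-cong (suc m) h = cong₂ _+_ (h zero) (sumℤ-cong m (λ i → h (suc i)))

sumℤ-zero : ∀ m {f : Fin m → ℤ} → (∀ i → f i ≡ + 0) → sumℤ m f ≡ + 0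
sumℤ-zero zero    h = refl
sumℤ-zero (suc m) h = cong₂ _+_ (h zero) (sumℤ-zero m (λ i → h (suc i)))

sumℤ-distrib-+ : ∀ m (f g : Fin m → ℤ) → sumℤ m (λ i → f i + g i) ≡ sumℤ m f + sumℤ m g
sumℤ-distrib-+ zero    f g = refl
sumℤ-distrib-+ (suc m) f g
  rewrite sumℤ-distrib-+ m (λ i → f (suc i)) (λ i → g (suc i)) = shuffle (f zero) (g zero) _ _
  where shuffle : ∀ a b c d → (a + b) + (c + d) ≡ (a + c) + (b + d)
        shuffle = solve-∀

sumℤ-*ˡ : ∀ m (a : ℤ) (f : Fin m → ℤ) → sumℤ m (λ i → a * f i) ≡ a * sumℤ m f
sumℤ-*ˡ zero    a f = sym (ℤP.*-zeroʳ a)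
sumℤ-*ˡ (suc m) a f
  rewrite sumℤ-*ˡ m a (λ i → f (suc i)) = sym (ℤP.*-distribˡ-+ a (f zero) _)

sumℤ-*ʳ : ∀ m (f : Fin m → ℤ) (a : ℤ) → sumℤ m (λ i → f i * a) ≡ sumℤ m f * a
sumℤ-*ʳ m f a = begin
  sumℤ m (λ i → f i * a) ≡⟨ sumℤ-cong m (λ i → ℤP.*-comm (f i) a) ⟩
  sumℤ m (λ i → a * f i) ≡⟨ sumℤ-*ˡ m a f ⟩
  a * sumℤ m f           ≡⟨ ℤP.*-comm a _ ⟩
  sumℤ m f * a           ∎
  where open ≡-Reasoning

sumℤ-const : ∀ m (c : ℤ) → sumℤ m (λ _ → c) ≡ c * + m
sumℤ-const zero    c = sym (ℤP.*-zeroʳ c)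
sumℤ-const (suc m) c rewrite sumℤ-const m c = distrib c (+ m)
  where distrib : ∀ c x → c + c * x ≡ c * (+ 1 + x)
        distrib = solve-∀

sumℤ-+ : ∀ m (f : Fin m → ℕ) → sumℤ m (λ i → + f i) ≡ + sumℕ m f
sumℤ-+ zero    f = refl
sumℤ-+ (suc m) f rewrite sumℤ-+ m (λ i → f (suc i)) = sym (ℤP.pos-+ (f zero) _)

sumℤ-punchIn : ∀ m (f : Fin (suc m) → ℤ) (k : Fin (suc m)) →
  sumℤ (suc m) f ≡ f k + sumℤ m (λ j → f (punchIn k j))
sumℤ-punchIn m       f zero    = refl
sumℤ-punchIn (suc m) f (suc k)
  rewrite sumℤ-punchIn m (λ i → f (suc i)) k = swap (f zero) (f (suc k)) _
  where swap : ∀ a b c → a + (b + c) ≡ b + (a + c)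
        swap = solve-∀

sumℤ-swap : ∀ m p (f : Fin m → Fin p → ℤ) →
  sumℤ m (λ i → sumℤ p (f i)) ≡ sumℤ p (λ j → sumℤ m (λ i → f i j))
sumℤ-swap zero    p f = sym (sumℤ-zero p (λ _ → refl))
sumℤ-swap (suc m) p f rewrite sumℤ-swap m p (λ i → f (suc i)) =
  sym (sumℤ-distrib-+ p (f zero) (λ j → sumℤ m (λ i → f (suc i) j)))

sumℤ-↑ : ∀ m p (f : Fin (m ℕ.+ p) → ℤ) →
  sumℤ (m ℕ.+ p) f ≡ sumℤ m (λ i → f (i ↑ˡ p)) + sumℤ p (λ j → f (m ↑ʳ j))
sumℤ-↑ zero    p f = sym (ℤP.+-identityˡ _)
sumℤ-↑ (suc m) p f rewrite sumℤ-↑ m p (λ i → f (suc i)) = sym (ℤP.+-assoc (f zero) _ _)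

≟-refl : ∀ {m} (i : Fin m) → ⌊ i ≟ i ⌋ ≡ true
≟-refl i with i ≟ i
... | yes _  = refl
... | no i≢i = ⊥-elim (i≢i refl)

≟-≢ : ∀ {m} {i j : Fin m} → i ≢ j → ⌊ i ≟ j ⌋ ≡ false
≟-≢ {i = i} {j} i≢j with i ≟ j
... | yes i≡j = ⊥-elim (i≢j i≡j)
... | no _    = refl

≟-true : ∀ {m} {i j : Fin m} → ⌊ i ≟ j ⌋ ≡ true → i ≡ j
≟-true {i = i} {j} eq with i ≟ j
... | yes i≡j = i≡j

≟-sym : ∀ {m} (i j : Fin m) → ⌊ i ≟ j ⌋ ≡ ⌊ j ≟ i ⌋
≟-sym i j with i ≟ j
... | yes refl = sym (≟-refl i)
... | no i≢j   = sym (≟-≢ (i≢j ∘ sym))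

δ-refl : ∀ {m} (i : Fin m) → δ i i ≡ + 1
δ-refl i = cong (λ b → if b then + 1 else + 0) (≟-refl i)

δ-≢ : ∀ {m} {i j : Fin m} → i ≢ j → δ i j ≡ + 0
δ-≢ i≢j = cong (λ b → if b then + 1 else + 0) (≟-≢ i≢j)

δ-sym : ∀ {m} (i j : Fin m) → δ i j ≡ δ j i
δ-sym i j = cong (λ b → if b then + 1 else + 0) (≟-sym i j)

sumℤ-δ : ∀ m (t : Fin m) (f : Fin m → ℤ) → sumℤ m (λ d → δ d t * f d) ≡ f t
sumℤ-δ (suc m) zero f =
  trans (cong₂ _+_ (ℤP.*-identityˡ (f zero)) (sumℤ-zero m (λ i → ℤP.*-zeroˡ (f (suc i)))))
        (ℤP.+-identityʳ (f zero))
sumℤ-δ (suc m) (suc t) f =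
  trans (cong₂ _+_ (ℤP.*-zeroˡ (f zero))
          (trans (sumℤ-cong m (λ i → cong (_* f (suc i)) (δ-suc i t))) (sumℤ-δ m t (λ i → f (suc i)))))
        (ℤP.+-identityˡ (f (suc t)))
  where
  δ-suc : ∀ {m} (i j : Fin m) → δ (suc i) (suc j) ≡ δ i j
  δ-suc i j with i ≟ j
  ... | yes _ = refl
  ... | no  _ = refl

sign-suc : ∀ k → sign (suc k) ≡ - sign k
sign-suc zero          = refl
sign-suc (suc zero)    = refl
sign-suc (suc (suc k)) = sign-suc k

sign*sign : ∀ k → sign k * sign k ≡ + 1
sign*sign zero          = refl
sign*sign (suc zero)    = refl
sign*sign (suc (suc k)) = sign*sign k

det-cong : ∀ m {M N : Mat m} → (∀ r c → M r c ≡ N r c) → det m M ≡ det m N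
det-cong zero    h = refl
det-cong (suc m) h = sumℤ-cong (suc m) λ j →
  cong₂ (λ a b → sign (toℕ j) * a * b) (h zero j) (det-cong m (λ r c → h (suc r) (punchIn j c)))

minor : ∀ {m} → Mat (suc m) → Fin (suc m) → Mat m
minor M j r c = M (suc r) (punchIn j c)

cofactorTerm : ∀ {m} → Mat (suc m) → Fin (suc m) → ℤ
cofactorTerm {m} M j = sign (toℕ j) * M zero j * det m (minor M j)

det-firstColumn : ∀ m (M : Mat (suc m)) → det (suc m) M ≡
  sumℤ (suc m) (λ i → sign (toℕ i) * M i zero * det m (λ r c → M (punchIn i r) (suc c)))
det-firstColumn zero    M = refl
det-firstColumn (suc m) M = cong (λ s → cofactorTerm M zero + s) (begin
  sumℤ (suc m) (λ j → cofactorTerm M (suc j))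
    ≡⟨ sumℤ-cong (suc m) (λ j → cong (sign (toℕ (suc j)) * a j *_) (det-firstColumn m (minor M (suc j)))) ⟩
  sumℤ (suc m) (λ j → sign (toℕ (suc j)) * a j * sumℤ (suc m) (λ i → sign (toℕ i) * b i * D i j))
    ≡⟨ sumℤ-cong (suc m) (λ j → sym (sumℤ-*ˡ (suc m) (sign (toℕ (suc j)) * a j) (λ i → sign (toℕ i) * b i * D i j))) ⟩
  sumℤ (suc m) (λ j → sumℤ (suc m) (λ i → sign (toℕ (suc j)) * a j * (sign (toℕ i) * b i * D i j)))
    ≡⟨ sumℤ-swap (suc m) (suc m) (λ j i → sign (toℕ (suc j)) * a j * (sign (toℕ i) * b i * D i j)) ⟩
  sumℤ (suc m) (λ i → sumℤ (suc m) (λ j → sign (toℕ (suc j)) * a j * (sign (toℕ i) * b i * D i j)))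
    ≡⟨ sumℤ-cong (suc m) (λ i → sumℤ-cong (suc m) (λ j → exchange i j)) ⟩
  sumℤ (suc m) (λ i → sumℤ (suc m) (λ j → sign (toℕ (suc i)) * b i * (sign (toℕ j) * a j * D i j)))
    ≡⟨ sumℤ-cong (suc m) (λ i → sumℤ-*ˡ (suc m) (sign (toℕ (suc i)) * b i) (λ j → sign (toℕ j) * a j * D i j)) ⟩
  sumℤ (suc m) (λ i → sign (toℕ (suc i)) * b i * det (suc m) (λ r c → M (punchIn (suc i) r) (suc c)))
    ∎)
  where
  open ≡-Reasoning
  a b : Fin (suc m) → ℤ
  a j = M zero (suc j)
  b i = M (suc i) zero
  D : Fin (suc m) → Fin (suc m) → ℤ
  D i j = det m (λ r c → M (suc (punchIn i r)) (suc (punchIn j c)))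
  exchange : ∀ i j → sign (toℕ (suc j)) * a j * (sign (toℕ i) * b i * D i j)
                   ≡ sign (toℕ (suc i)) * b i * (sign (toℕ j) * a j * D i j)
  exchange i j rewrite sign-suc (toℕ i) | sign-suc (toℕ j) =
    ring (sign (toℕ i)) (sign (toℕ j)) (a j) (b i) (D i j)
    where ring : ∀ si sj x y d → - sj * x * (si * y * d) ≡ - si * y * (sj * x * d)
          ring = solve-∀

det-transpose : ∀ m (M : Mat m) → det m (λ r c → M c r) ≡ det m M
det-transpose zero    M = refl
det-transpose (suc m) M =
  trans (sumℤ-cong (suc m) (λ j → cong (sign (toℕ j) * M j zero *_)
          (det-transpose m (λ r c → M (punchIn j r) (suc c)))))
        (sym (det-firstColumn m M))

pivot : ∀ {m} → Fin (suc m) → Fin (suc m) → Fin (suc m)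
pivot k zero    = k
pivot k (suc c) = punchIn k c

-- The position of k among the indices that remain once punchIn k j is deleted.
relPos : ∀ {m} → Fin (suc m) → Fin m → Fin m
relPos {suc m} zero    j       = zero
relPos {suc m} (suc k) zero    = k
relPos {suc m} (suc k) (suc j) = suc (relPos k j)

punchIn-relPos : ∀ {m} (k : Fin (suc m)) (j : Fin m) → punchIn (punchIn k j) (relPos k j) ≡ k
punchIn-relPos {suc m} zero    j       = refl
punchIn-relPos {suc m} (suc k) zero    = refl
punchIn-relPos {suc m} (suc k) (suc j) = cong suc (punchIn-relPos k j)

punchIn-punchIn : ∀ {m} (k : Fin (suc (suc m))) (j : Fin (suc m)) (c : Fin m) →
  punchIn k (punchIn j c) ≡ punchIn (punchIn k j) (punchIn (relPos k j) c)
punchIn-punchIn zero    j       c       = refl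
punchIn-punchIn (suc k) zero    c       = refl
punchIn-punchIn (suc k) (suc j) zero    = refl
punchIn-punchIn (suc k) (suc j) (suc c) = cong suc (punchIn-punchIn k j c)

sign-relPos : ∀ {m} (k : Fin (suc m)) (j : Fin m) →
  sign (toℕ (suc j)) * sign (toℕ (relPos k j)) ≡ sign (toℕ k) * sign (toℕ (punchIn k j))
sign-relPos {suc m} zero    j    = ℤP.*-comm (sign (toℕ (suc j))) (+ 1)
sign-relPos {suc m} (suc k) zero rewrite sign-suc (toℕ k) = ring (sign (toℕ k))
  where ring : ∀ a → - (+ 1) * a ≡ - a * (+ 1)
        ring = solve-∀
sign-relPos {suc m} (suc k) (suc j) = begin
  sign (toℕ j) * sign (suc (toℕ (relPos k j)))  ≡⟨ cong (sign (toℕ j) *_) (sign-suc (toℕ (relPos k j))) ⟩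
  sign (toℕ j) * - sign (toℕ (relPos k j))      ≡⟨ moveNeg (sign (toℕ j)) _ ⟩
  - sign (toℕ j) * sign (toℕ (relPos k j))      ≡⟨ cong (_* sign (toℕ (relPos k j))) (sym (sign-suc (toℕ j))) ⟩
  sign (toℕ (suc j)) * sign (toℕ (relPos k j))  ≡⟨ sign-relPos k j ⟩
  sign (toℕ k) * sign (toℕ (punchIn k j))       ≡⟨ negNeg (sign (toℕ k)) _ ⟩
  - sign (toℕ k) * - sign (toℕ (punchIn k j))   ≡⟨ sym (cong₂ _*_ (sign-suc (toℕ k)) (sign-suc (toℕ (punchIn k j)))) ⟩
  sign (suc (toℕ k)) * sign (suc (toℕ (punchIn k j))) ∎
  where open ≡-Reasoning
        moveNeg : ∀ a b → a * - b ≡ - a * b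
        moveNeg = solve-∀
        negNeg : ∀ c d → c * d ≡ - c * - d
        negNeg = solve-∀

det-pivot : ∀ m (M : Mat (suc m)) (k : Fin (suc m)) →
  det (suc m) (λ r c → M r (pivot k c)) ≡ sign (toℕ k) * det (suc m) M
det-pivot zero    M zero = sym (ℤP.*-identityˡ _)
det-pivot (suc m) M k    = begin
  det (suc (suc m)) (λ r c → M r (pivot k c))
    ≡⟨ cong₂ _+_ (sign-square (sign (toℕ k)) (M zero k) (det (suc m) (minor M k)) (sign*sign (toℕ k)))
                 (sumℤ-cong (suc m) pivotedTerm) ⟩
  s * cofactorTerm M k + sumℤ (suc m) (λ j → s * cofactorTerm M (punchIn k j))
    ≡⟨ cong (λ z → s * cofactorTerm M k + z) (sumℤ-*ˡ (suc m) s (λ j → cofactorTerm M (punchIn k j))) ⟩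
  s * cofactorTerm M k + s * sumℤ (suc m) (λ j → cofactorTerm M (punchIn k j))
    ≡⟨ sym (ℤP.*-distribˡ-+ s (cofactorTerm M k) _) ⟩
  s * (cofactorTerm M k + sumℤ (suc m) (λ j → cofactorTerm M (punchIn k j)))
    ≡⟨ cong (s *_) (sym (sumℤ-punchIn (suc m) (cofactorTerm M) k)) ⟩
  s * det (suc (suc m)) M
    ∎
  where
  open ≡-Reasoning
  s : ℤ
  s = sign (toℕ k)
  sign-square : ∀ s a b → s * s ≡ + 1 → + 1 * a * b ≡ s * (s * a * b)
  sign-square s a b s²≡1 = trans (cong (λ z → z * a * b) (sym s²≡1)) (ring s a b)
    where ring : ∀ s a b → s * s * a * b ≡ s * (s * a * b)
          ring = solve-∀
  regroup : ∀ a b c d x y → a * b ≡ c * d → a * x * (b * y) ≡ c * (d * x * y)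
  regroup a b c d x y ab≡cd = trans (ring₁ a b x y) (trans (cong (_* (x * y)) ab≡cd) (ring₂ c d x y))
    where ring₁ : ∀ a b x y → a * x * (b * y) ≡ (a * b) * (x * y)
          ring₁ = solve-∀
          ring₂ : ∀ c d x y → (c * d) * (x * y) ≡ c * (d * x * y)
          ring₂ = solve-∀
  pivotedMinor : ∀ j r c → M (suc r) (pivot k (punchIn (suc j) c))
                         ≡ minor M (punchIn k j) r (pivot (relPos k j) c)
  pivotedMinor j r zero    = cong (M (suc r)) (sym (punchIn-relPos k j))
  pivotedMinor j r (suc c) = cong (M (suc r)) (punchIn-punchIn k j c)
  pivotedTerm : ∀ j → sign (toℕ (suc j)) * M zero (punchIn k j) *
                      det (suc m) (λ r c → M (suc r) (pivot k (punchIn (suc j) c)))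
                    ≡ s * cofactorTerm M (punchIn k j)
  pivotedTerm j =
    trans (cong (sign (toℕ (suc j)) * M zero (punchIn k j) *_)
             (trans (det-cong (suc m) (pivotedMinor j)) (det-pivot m (minor M (punchIn k j)) (relPos k j))))
          (regroup (sign (toℕ (suc j))) (sign (toℕ (relPos k j))) s (sign (toℕ (punchIn k j)))
                   (M zero (punchIn k j)) (det (suc m) (minor M (punchIn k j))) (sign-relPos k j))

det-unpivot : ∀ m {M N : Mat (suc m)} (k : Fin (suc m)) →
  det (suc m) (λ r c → M r (pivot k c)) ≡ det (suc m) (λ r c → N r (pivot k c)) →
  det (suc m) M ≡ det (suc m) N
det-unpivot m {M} {N} k eq = begin
  det (suc m) M                             ≡⟨ sym (unit (det (suc m) M)) ⟩
  s * (s * det (suc m) M)                   ≡⟨ cong (s *_) (sym (det-pivot m M k)) ⟩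
  s * det (suc m) (λ r c → M r (pivot k c)) ≡⟨ cong (s *_) eq ⟩
  s * det (suc m) (λ r c → N r (pivot k c)) ≡⟨ cong (s *_) (det-pivot m N k) ⟩
  s * (s * det (suc m) N)                   ≡⟨ unit (det (suc m) N) ⟩
  det (suc m) N                             ∎
  where
  open ≡-Reasoning
  s : ℤ
  s = sign (toℕ k)
  unit : ∀ x → s * (s * x) ≡ x
  unit x = trans (sym (ℤP.*-assoc s s x)) (trans (cong (_* x) (sign*sign (toℕ k))) (ℤP.*-identityˡ x))

consCol : ∀ {m} → (Fin (suc m) → ℤ) → (Fin (suc m) → Fin m → ℤ) → Mat (suc m)
consCol v B r zero    = v r
consCol v B r (suc c) = B r c

consCol-cong : ∀ {m} {v v′ : Fin (suc m) → ℤ} (B : Fin (suc m) → Fin m → ℤ) →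
  (∀ r → v r ≡ v′ r) → ∀ r c → consCol v B r c ≡ consCol v′ B r c
consCol-cong B v≡v′ r zero    = v≡v′ r
consCol-cong B v≡v′ r (suc c) = refl

colCofactor : ∀ {m} → (Fin (suc m) → Fin m → ℤ) → Fin (suc m) → ℤ
colCofactor {m} B i = sign (toℕ i) * det m (λ r c → B (punchIn i r) c)

det-consCol : ∀ m (v : Fin (suc m) → ℤ) B →
  det (suc m) (consCol v B) ≡ sumℤ (suc m) (λ i → v i * colCofactor B i)
det-consCol m v B =
  trans (det-firstColumn m (consCol v B))
        (sumℤ-cong (suc m) (λ i → ring (sign (toℕ i)) (v i) (det m (λ r c → B (punchIn i r) c))))
  where ring : ∀ s x d → s * x * d ≡ x * (s * d)
        ring = solve-∀

det-consCol-+ : ∀ m (u w : Fin (suc m) → ℤ) B →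
  det (suc m) (consCol (λ r → u r + w r) B) ≡ det (suc m) (consCol u B) + det (suc m) (consCol w B)
det-consCol-+ m u w B = begin
  det (suc m) (consCol (λ r → u r + w r) B)
    ≡⟨ det-consCol m (λ r → u r + w r) B ⟩
  sumℤ (suc m) (λ i → (u i + w i) * colCofactor B i)
    ≡⟨ sumℤ-cong (suc m) (λ i → ℤP.*-distribʳ-+ (colCofactor B i) (u i) (w i)) ⟩
  sumℤ (suc m) (λ i → u i * colCofactor B i + w i * colCofactor B i)
    ≡⟨ sumℤ-distrib-+ (suc m) (λ i → u i * colCofactor B i) (λ i → w i * colCofactor B i) ⟩
  sumℤ (suc m) (λ i → u i * colCofactor B i) + sumℤ (suc m) (λ i → w i * colCofactor B i)
    ≡⟨ sym (cong₂ _+_ (det-consCol m u B) (det-consCol m w B)) ⟩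
  det (suc m) (consCol u B) + det (suc m) (consCol w B)
    ∎
  where open ≡-Reasoning

det-consCol-* : ∀ m (α : ℤ) (u : Fin (suc m) → ℤ) B →
  det (suc m) (consCol (λ r → α * u r) B) ≡ α * det (suc m) (consCol u B)
det-consCol-* m α u B = begin
  det (suc m) (consCol (λ r → α * u r) B)            ≡⟨ det-consCol m (λ r → α * u r) B ⟩
  sumℤ (suc m) (λ i → α * u i * colCofactor B i)     ≡⟨ sumℤ-cong (suc m) (λ i → ℤP.*-assoc α (u i) (colCofactor B i)) ⟩
  sumℤ (suc m) (λ i → α * (u i * colCofactor B i))   ≡⟨ sumℤ-*ˡ (suc m) α (λ i → u i * colCofactor B i) ⟩
  α * sumℤ (suc m) (λ i → u i * colCofactor B i)     ≡⟨ cong (α *_) (sym (det-consCol m u B)) ⟩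
  α * det (suc m) (consCol u B)                      ∎
  where open ≡-Reasoning

det-consCol-sum : ∀ m p (V : Fin p → Fin (suc m) → ℤ) B →
  det (suc m) (consCol (λ r → sumℤ p (λ e → V e r)) B) ≡ sumℤ p (λ e → det (suc m) (consCol (V e) B))
det-consCol-sum m p V B = begin
  det (suc m) (consCol (λ r → sumℤ p (λ e → V e r)) B)
    ≡⟨ det-consCol m (λ r → sumℤ p (λ e → V e r)) B ⟩
  sumℤ (suc m) (λ i → sumℤ p (λ e → V e i) * colCofactor B i)
    ≡⟨ sumℤ-cong (suc m) (λ i → sym (sumℤ-*ʳ p (λ e → V e i) (colCofactor B i))) ⟩
  sumℤ (suc m) (λ i → sumℤ p (λ e → V e i * colCofactor B i))
    ≡⟨ sumℤ-swap (suc m) p (λ i e → V e i * colCofactor B i) ⟩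
  sumℤ p (λ e → sumℤ (suc m) (λ i → V e i * colCofactor B i))
    ≡⟨ sumℤ-cong p (λ e → sym (det-consCol m (V e) B)) ⟩
  sumℤ p (λ e → det (suc m) (consCol (V e) B))
    ∎
  where open ≡-Reasoning

-- Expanding along the first row, the term of column d cancels the leading term, and every other
-- minor again has its first column repeated.
det-consCol-repeat : ∀ m (B : Fin (suc m) → Fin m → ℤ) (d : Fin m) →
  det (suc m) (consCol (λ r → B r d) B) ≡ + 0
det-consCol-repeat (suc m) B d = begin
  + 1 * B zero d * D₀ + sumℤ (suc m) term
    ≡⟨ cong (λ z → + 1 * B zero d * D₀ + z) (sumℤ-punchIn m term d) ⟩
  + 1 * B zero d * D₀ + (term d + sumℤ m (λ e → term (punchIn d e)))
    ≡⟨ cong₂ (λ x y → + 1 * B zero d * D₀ + (x + y)) term-d (sumℤ-zero m term-punchIn) ⟩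
  + 1 * B zero d * D₀ + (sign (suc (toℕ d)) * B zero d * (sign (toℕ d) * D₀) + + 0)
    ≡⟨ cong (λ s → + 1 * B zero d * D₀ + (s * B zero d * (sign (toℕ d) * D₀) + + 0)) (sign-suc (toℕ d)) ⟩
  + 1 * B zero d * D₀ + (- sign (toℕ d) * B zero d * (sign (toℕ d) * D₀) + + 0)
    ≡⟨ ring (B zero d) D₀ (sign (toℕ d)) ⟩
  B zero d * D₀ - sign (toℕ d) * sign (toℕ d) * (B zero d * D₀)
    ≡⟨ cong (λ z → B zero d * D₀ - z * (B zero d * D₀)) (sign*sign (toℕ d)) ⟩
  B zero d * D₀ - + 1 * (B zero d * D₀)
    ≡⟨ cancel (B zero d * D₀) ⟩
  + 0
    ∎
  where
  open ≡-Reasoning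
  v : Fin (suc (suc m)) → ℤ
  v r = B r d
  D₀ : ℤ
  D₀ = det (suc m) (λ r c → B (suc r) c)
  term : Fin (suc m) → ℤ
  term j = sign (toℕ (suc j)) * B zero j * det (suc m) (λ r c → consCol v B (suc r) (punchIn (suc j) c))
  term-d : term d ≡ sign (toℕ (suc d)) * B zero d * (sign (toℕ d) * D₀)
  term-d = cong (sign (toℕ (suc d)) * B zero d *_)
              (trans (det-cong (suc m) pivoted) (det-pivot m (λ r c → B (suc r) c) d))
    where pivoted : ∀ r c → consCol v B (suc r) (punchIn (suc d) c) ≡ B (suc r) (pivot d c)
          pivoted r zero    = refl
          pivoted r (suc c) = refl
  term-punchIn : ∀ e → term (punchIn d e) ≡ + 0
  term-punchIn e =
    trans (cong (sign (toℕ (suc j)) * B zero j *_)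
            (trans (det-cong (suc m) repeated) (det-consCol-repeat m B′ (relPos d e))))
          (ℤP.*-zeroʳ (sign (toℕ (suc j)) * B zero j))
    where
    j = punchIn d e
    B′ : Fin (suc m) → Fin m → ℤ
    B′ r c = B (suc r) (punchIn j c)
    repeated : ∀ r c → consCol v B (suc r) (punchIn (suc j) c) ≡ consCol (λ r → B′ r (relPos d e)) B′ r c
    repeated r zero    = cong (B (suc r)) (sym (punchIn-relPos d e))
    repeated r (suc c) = refl
  ring : ∀ b x s → + 1 * b * x + (- s * b * (s * x) + + 0) ≡ b * x - s * s * (b * x)
  ring = solve-∀
  cancel : ∀ y → y - + 1 * y ≡ + 0
  cancel = solve-∀

det-consCol-addCols : ∀ m (v : Fin (suc m) → ℤ) (a : Fin m → ℤ) (B : Fin (suc m) → Fin m → ℤ) →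
  det (suc m) (consCol (λ r → v r + sumℤ m (λ e → a e * B r e)) B) ≡ det (suc m) (consCol v B)
det-consCol-addCols m v a B = begin
  det (suc m) (consCol (λ r → v r + sumℤ m (λ e → a e * B r e)) B)
    ≡⟨ det-consCol-+ m v _ B ⟩
  det (suc m) (consCol v B) + det (suc m) (consCol (λ r → sumℤ m (λ e → a e * B r e)) B)
    ≡⟨ cong (λ z → det (suc m) (consCol v B) + z) (det-consCol-sum m m (λ e r → a e * B r e) B) ⟩
  det (suc m) (consCol v B) + sumℤ m (λ e → det (suc m) (consCol (λ r → a e * B r e) B))
    ≡⟨ cong (λ z → det (suc m) (consCol v B) + z) (sumℤ-zero m repeatedCol) ⟩
  det (suc m) (consCol v B) + + 0
    ≡⟨ ℤP.+-identityʳ _ ⟩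
  det (suc m) (consCol v B)
    ∎
  where
  open ≡-Reasoning
  repeatedCol : ∀ e → det (suc m) (consCol (λ r → a e * B r e) B) ≡ + 0
  repeatedCol e = trans (det-consCol-* m (a e) (λ r → B r e) B)
                        (trans (cong (a e *_) (det-consCol-repeat m B e)) (ℤP.*-zeroʳ (a e)))

det-addCols : ∀ m (M : Mat (suc m)) (k : Fin (suc m)) (a : Fin m → ℤ) →
  det (suc m) (λ r c → M r c + δ c k * sumℤ m (λ e → a e * M r (punchIn k e))) ≡ det (suc m) M
det-addCols m M k a = det-unpivot m {M′} {M} k (begin
  det (suc m) (λ r c → M′ r (pivot k c))
    ≡⟨ det-cong (suc m) pivoted ⟩
  det (suc m) (consCol (λ r → M r k + sumℤ m (λ e → a e * B r e)) B)
    ≡⟨ det-consCol-addCols m (λ r → M r k) a B ⟩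
  det (suc m) (consCol (λ r → M r k) B)
    ≡⟨ det-cong (suc m) unpivoted ⟩
  det (suc m) (λ r c → M r (pivot k c))
    ∎)
  where
  open ≡-Reasoning
  M′ : Mat (suc m)
  M′ r c = M r c + δ c k * sumℤ m (λ e → a e * M r (punchIn k e))
  B : Fin (suc m) → Fin m → ℤ
  B r e = M r (punchIn k e)
  pivoted : ∀ r c → M′ r (pivot k c) ≡ consCol (λ r → M r k + sumℤ m (λ e → a e * B r e)) B r c
  pivoted r zero    = cong (λ z → M r k + z)
                        (trans (cong (_* sumℤ m (λ e → a e * B r e)) (δ-refl k)) (ℤP.*-identityˡ _))
  pivoted r (suc c) = trans (cong (λ z → M r (punchIn k c) + z * sumℤ m (λ e → a e * B r e))
                                  (δ-≢ (FinP.punchInᵢ≢i k c)))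
                            (ℤP.+-identityʳ _)
  unpivoted : ∀ r c → consCol (λ r → M r k) B r c ≡ M r (pivot k c)
  unpivoted r zero    = refl
  unpivoted r (suc c) = refl

-- The columns are updated one at a time, in increasing order; since no target column is ever a
-- source, each update adds a combination of columns of the current matrix, which is det-addCols.
module ColumnSweep {m′ : ℕ} (M : Mat (suc m′)) (a : Fin (suc m′) → Fin (suc m′) → ℤ) (target : Fin (suc m′) → Bool)
  (a-source : ∀ c d → target d ≡ true → a c d ≡ + 0) (a-target : ∀ c d → target c ≡ false → a c d ≡ + 0) where

  private
    m : ℕ
    m = suc m′

  combo : Mat m
  combo r c = sumℤ m (λ d → a c d * M r d)

  sweep : ℕ → Mat m
  sweep k r c = if ⌊ toℕ c ℕ.<? k ⌋ then M r c + combo r c else M r c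

  sweep-< : ∀ k r c → toℕ c ℕ.< k → sweep k r c ≡ M r c + combo r c
  sweep-< k r c c<k with toℕ c ℕ.<? k
  ... | yes _  = refl
  ... | no c≮k = ⊥-elim (c≮k c<k)

  sweep-≮ : ∀ k r c → ¬ toℕ c ℕ.< k → sweep k r c ≡ M r c
  sweep-≮ k r c c≮k with toℕ c ℕ.<? k
  ... | yes c<k = ⊥-elim (c≮k c<k)
  ... | no _    = refl

  sweep-source : ∀ k r d → target d ≡ false → sweep k r d ≡ M r d
  sweep-source k r d source with toℕ d ℕ.<? k
  ... | yes _ = trans (cong (λ z → M r d + z) (sumℤ-zero m (λ d′ → trans (cong (_* M r d′) (a-target d d′ source))
                                                               (ℤP.*-zeroˡ (M r d′)))))
                      (ℤP.+-identityʳ (M r d))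
  ... | no _  = refl

  a-diag : ∀ c → a c c ≡ + 0
  a-diag c with target c in eq
  ... | true  = a-source c c eq
  ... | false = a-target c c eq

  combo-sweep : ∀ k c r → combo r c ≡ sumℤ m′ (λ e → a c (punchIn c e) * sweep k r (punchIn c e))
  combo-sweep k c r = begin
    sumℤ m (λ d → a c d * M r d)
      ≡⟨ sumℤ-punchIn m′ (λ d → a c d * M r d) c ⟩
    a c c * M r c + sumℤ m′ (λ e → a c (punchIn c e) * M r (punchIn c e))
      ≡⟨ cong₂ _+_ (trans (cong (_* M r c) (a-diag c)) (ℤP.*-zeroˡ (M r c)))
                   (sumℤ-cong m′ (λ e → unchanged (punchIn c e))) ⟩
    + 0 + sumℤ m′ (λ e → a c (punchIn c e) * sweep k r (punchIn c e))
      ≡⟨ ℤP.+-identityˡ _ ⟩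
    sumℤ m′ (λ e → a c (punchIn c e) * sweep k r (punchIn c e))
      ∎
    where
    open ≡-Reasoning
    unchanged : ∀ d → a c d * M r d ≡ a c d * sweep k r d
    unchanged d with target d in eq
    ... | true  = trans (cong (_* M r d) (a-source c d eq)) (sym (cong (_* sweep k r d) (a-source c d eq)))
    ... | false = cong (a c d *_) (sym (sweep-source k r d eq))

  sweep-step : ∀ k (k<m : k ℕ.< m) → det m (sweep (suc k)) ≡ det m (sweep k)
  sweep-step k k<m = trans (det-cong m addOne) (det-addCols m′ (sweep k) c₀ (λ e → a c₀ (punchIn c₀ e)))
    where
    c₀ : Fin m
    c₀ = fromℕ< k<m
    toℕ-c₀ : toℕ c₀ ≡ k
    toℕ-c₀ = FinP.toℕ-fromℕ< k<m
    added : Fin m → ℤ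
    added r = sumℤ m′ (λ e → a c₀ (punchIn c₀ e) * sweep k r (punchIn c₀ e))
    addOne : ∀ r c → sweep (suc k) r c ≡ sweep k r c + δ c c₀ * added r
    addOne r c with c ≟ c₀
    ... | yes refl = begin
      sweep (suc k) r c                   ≡⟨ sweep-< (suc k) r c (subst (ℕ._< suc k) (sym toℕ-c₀) (ℕP.n<1+n k)) ⟩
      M r c + combo r c                   ≡⟨ cong₂ _+_ (sym (sweep-≮ k r c (λ c<k → ℕP.<-irrefl toℕ-c₀ c<k)))
                                                   (trans (combo-sweep k c r) (sym (ℤP.*-identityˡ _))) ⟩
      sweep k r c + + 1 * added r         ∎
      where open ≡-Reasoning
    ... | no c≢c₀ = trans (sameSide (toℕ c ℕ.<? k))
                          (sym (trans (cong (λ z → sweep k r c + z) (ℤP.*-zeroˡ (added r)))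
                                      (ℤP.+-identityʳ (sweep k r c))))
      where
      c≢k : toℕ c ≢ k
      c≢k eq = c≢c₀ (FinP.toℕ-injective (trans eq (sym toℕ-c₀)))
      sameSide : Dec (toℕ c ℕ.< k) → sweep (suc k) r c ≡ sweep k r c
      sameSide (yes c<k) = trans (sweep-< (suc k) r c (ℕP.m<n⇒m<1+n c<k)) (sym (sweep-< k r c c<k))
      sameSide (no c≮k)  = trans (sweep-≮ (suc k) r c
                                   (λ c<1+k → c≢k (ℕP.≤-antisym (ℕP.m<1+n⇒m≤n c<1+k) (ℕP.≮⇒≥ c≮k))))
                                 (sym (sweep-≮ k r c c≮k))

  sweep-complete : ∀ k → k ℕ.≤ m → det m (sweep k) ≡ det m M
  sweep-complete zero    _   = det-cong m (λ r c → sweep-≮ zero r c (λ ()))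
  sweep-complete (suc k) k<m = trans (sweep-step k k<m) (sweep-complete k (ℕP.<⇒≤ k<m))

  det-sweep : det m (λ r c → M r c + combo r c) ≡ det m M
  det-sweep = trans (det-cong m (λ r c → sym (sweep-< m r c (FinP.toℕ<n c)))) (sweep-complete m ℕP.≤-refl)

det-addColumnCombinations : ∀ m (M : Mat m) (a : Fin m → Fin m → ℤ) (target : Fin m → Bool) →
  (∀ c d → target d ≡ true → a c d ≡ + 0) → (∀ c d → target c ≡ false → a c d ≡ + 0) →
  det m (λ r c → M r c + sumℤ m (λ d → a c d * M r d)) ≡ det m M
det-addColumnCombinations zero    M a target a-source a-target = refl
det-addColumnCombinations (suc m) M a target a-source a-target =
  ColumnSweep.det-sweep M a target a-source a-target

det-addRowCombinations : ∀ m (M : Mat m) (a : Fin m → Fin m → ℤ) (target : Fin m → Bool) →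
  (∀ c d → target d ≡ true → a c d ≡ + 0) → (∀ c d → target c ≡ false → a c d ≡ + 0) →
  det m (λ r c → M r c + sumℤ m (λ d → a r d * M d c)) ≡ det m M
det-addRowCombinations m M a target a-source a-target =
  trans (sym (det-transpose m (λ r c → M r c + sumℤ m (λ d → a r d * M d c))))
        (trans (det-addColumnCombinations m (λ r c → M c r) a target a-source a-target) (det-transpose m M))

↑-elim : ∀ {m p} {P : Fin (m ℕ.+ p) → Set} → (∀ i → P (i ↑ˡ p)) → (∀ j → P (m ↑ʳ j)) → ∀ c → P c
↑-elim {m} {p} {P} left right c = subst P (FinP.join-splitAt m p c) (byHalf (splitAt m c))
  where byHalf : ∀ x → P (Fin.join m p x)
        byHalf (inj₁ i) = left i
        byHalf (inj₂ j) = right j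

↑ˡ≢↑ʳ : ∀ {m p} (i : Fin m) (j : Fin p) → i ↑ˡ p ≢ m ↑ʳ j
↑ˡ≢↑ʳ {m} {p} i j eq with trans (sym (FinP.splitAt-↑ˡ m i p)) (trans (cong (splitAt m) eq) (FinP.splitAt-↑ʳ m p j))
... | ()

blockEntry : ∀ {m p} → Mat m → (Fin m → Fin p → ℤ) → (Fin p → Fin m → ℤ) → Mat p →
  Fin m ⊎ Fin p → Fin m ⊎ Fin p → ℤ
blockEntry X Y Z W (inj₁ i) (inj₁ j) = X i j
blockEntry X Y Z W (inj₁ i) (inj₂ j) = Y i j
blockEntry X Y Z W (inj₂ i) (inj₁ j) = Z i j
blockEntry X Y Z W (inj₂ i) (inj₂ j) = W i j

block : ∀ {m p} → Mat m → (Fin m → Fin p → ℤ) → (Fin p → Fin m → ℤ) → Mat p → Mat (m ℕ.+ p)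
block {m} X Y Z W r c = blockEntry X Y Z W (splitAt m r) (splitAt m c)

module _ {m p : ℕ} (X : Mat m) (Y : Fin m → Fin p → ℤ) (Z : Fin p → Fin m → ℤ) (W : Mat p) where

  block-↑ˡ-↑ˡ : ∀ i j → block X Y Z W (i ↑ˡ p) (j ↑ˡ p) ≡ X i j
  block-↑ˡ-↑ˡ i j = cong₂ (blockEntry X Y Z W) (FinP.splitAt-↑ˡ m i p) (FinP.splitAt-↑ˡ m j p)

  block-↑ˡ-↑ʳ : ∀ i j → block X Y Z W (i ↑ˡ p) (m ↑ʳ j) ≡ Y i j
  block-↑ˡ-↑ʳ i j = cong₂ (blockEntry X Y Z W) (FinP.splitAt-↑ˡ m i p) (FinP.splitAt-↑ʳ m p j)

  block-↑ʳ-↑ˡ : ∀ i j → block X Y Z W (m ↑ʳ i) (j ↑ˡ p) ≡ Z i j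
  block-↑ʳ-↑ˡ i j = cong₂ (blockEntry X Y Z W) (FinP.splitAt-↑ʳ m p i) (FinP.splitAt-↑ˡ m j p)

  block-↑ʳ-↑ʳ : ∀ i j → block X Y Z W (m ↑ʳ i) (m ↑ʳ j) ≡ W i j
  block-↑ʳ-↑ʳ i j = cong₂ (blockEntry X Y Z W) (FinP.splitAt-↑ʳ m p i) (FinP.splitAt-↑ʳ m p j)

block-cong : ∀ {m p} {X X′ : Mat m} {Y Y′ : Fin m → Fin p → ℤ} {Z Z′ : Fin p → Fin m → ℤ} {W W′ : Mat p} →
  (∀ i j → X i j ≡ X′ i j) → (∀ i j → Y i j ≡ Y′ i j) → (∀ i j → Z i j ≡ Z′ i j) → (∀ i j → W i j ≡ W′ i j) →
  ∀ r c → block X Y Z W r c ≡ block X′ Y′ Z′ W′ r c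
block-cong {m} X≡ Y≡ Z≡ W≡ r c with splitAt m r | splitAt m c
... | inj₁ i | inj₁ j = X≡ i j
... | inj₁ i | inj₂ j = Y≡ i j
... | inj₂ i | inj₁ j = Z≡ i j
... | inj₂ i | inj₂ j = W≡ i j

block-leftColumn : ∀ {m p} {X : Mat m} {Y Y′ : Fin m → Fin p → ℤ} {Z : Fin p → Fin m → ℤ} {W W′ : Mat p} r j →
  block X Y Z W r (j ↑ˡ p) ≡ block X Y′ Z W′ r (j ↑ˡ p)
block-leftColumn {m} {p} r j rewrite FinP.splitAt-↑ˡ m j p with splitAt m r
... | inj₁ _ = refl
... | inj₂ _ = refl

block-bottomRow : ∀ {m p} {X X′ : Mat m} {Y Y′ : Fin m → Fin p → ℤ} {Z : Fin p → Fin m → ℤ} {W : Mat p} i c →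
  block X Y Z W (m ↑ʳ i) c ≡ block X′ Y′ Z W (m ↑ʳ i) c
block-bottomRow {m} {p} i c rewrite FinP.splitAt-↑ʳ m p i with splitAt m c
... | inj₁ _ = refl
... | inj₂ _ = refl

splitAt-punchIn-↑ˡ : ∀ m p (j : Fin (suc m)) (c : Fin (m ℕ.+ p)) →
  splitAt (suc m) (punchIn (j ↑ˡ p) c) ≡ map₁ (punchIn j) (splitAt m c)
splitAt-punchIn-↑ˡ m       p zero    c       = refl
splitAt-punchIn-↑ˡ (suc m) p (suc j) zero    = refl
splitAt-punchIn-↑ˡ (suc m) p (suc j) (suc c) with splitAt m c | splitAt-punchIn-↑ˡ m p j c
... | inj₁ _ | ih = cong (map₁ suc) ih
... | inj₂ _ | ih = cong (map₁ suc) ih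

minor-block : ∀ m p (X : Mat (suc m)) Y Z (W : Mat p) (j : Fin (suc m)) r c →
  minor (block X Y Z W) (j ↑ˡ p) r c
    ≡ block (minor X j) (λ r c → Y (suc r) c) (λ r c → Z r (punchIn j c)) W r c
minor-block m p X Y Z W j r c rewrite splitAt-punchIn-↑ˡ m p j c with splitAt m r | splitAt m c
... | inj₁ _ | inj₁ _ = refl
... | inj₁ _ | inj₂ _ = refl
... | inj₂ _ | inj₁ _ = refl
... | inj₂ _ | inj₂ _ = refl

det-blockLowerTriangular : ∀ m p (X : Mat m) (Z : Fin p → Fin m → ℤ) (W : Mat p) →
  det (m ℕ.+ p) (block X (λ _ _ → + 0) Z W) ≡ det m X * det p W
det-blockLowerTriangular zero    p X Z W = sym (ℤP.*-identityˡ _)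
det-blockLowerTriangular (suc m) p X Z W = begin
  sumℤ (suc m ℕ.+ p) (cofactorTerm B)
    ≡⟨ sumℤ-↑ (suc m) p (cofactorTerm B) ⟩
  sumℤ (suc m) (λ j → cofactorTerm B (j ↑ˡ p)) + sumℤ p (λ j → cofactorTerm B (suc m ↑ʳ j))
    ≡⟨ cong₂ _+_ (sumℤ-cong (suc m) leftTerm) (sumℤ-zero p rightTerm) ⟩
  sumℤ (suc m) (λ j → cofactorTerm X j * det p W) + + 0
    ≡⟨ ℤP.+-identityʳ _ ⟩
  sumℤ (suc m) (λ j → cofactorTerm X j * det p W)
    ≡⟨ sumℤ-*ʳ (suc m) (cofactorTerm X) (det p W) ⟩
  det (suc m) X * det p W
    ∎
  where
  open ≡-Reasoning
  O : Fin (suc m) → Fin p → ℤ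
  O _ _ = + 0
  B : Mat (suc m ℕ.+ p)
  B = block X O Z W
  leftTerm : ∀ j → cofactorTerm B (j ↑ˡ p) ≡ cofactorTerm X j * det p W
  leftTerm j = begin
    sign (toℕ (j ↑ˡ p)) * B zero (j ↑ˡ p) * det (m ℕ.+ p) (minor B (j ↑ˡ p))
      ≡⟨ cong₂ (λ s x → sign s * x * det (m ℕ.+ p) (minor B (j ↑ˡ p)))
               (FinP.toℕ-↑ˡ j p) (block-↑ˡ-↑ˡ X O Z W zero j) ⟩
    sign (toℕ j) * X zero j * det (m ℕ.+ p) (minor B (j ↑ˡ p))
      ≡⟨ cong (sign (toℕ j) * X zero j *_) (det-cong (m ℕ.+ p) (minor-block m p X O Z W j)) ⟩
    sign (toℕ j) * X zero j * det (m ℕ.+ p) (block (minor X j) (λ _ _ → + 0) (λ r c → Z r (punchIn j c)) W)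
      ≡⟨ cong (sign (toℕ j) * X zero j *_) (det-blockLowerTriangular m p (minor X j) (λ r c → Z r (punchIn j c)) W) ⟩
    sign (toℕ j) * X zero j * (det m (minor X j) * det p W)
      ≡⟨ sym (ℤP.*-assoc (sign (toℕ j) * X zero j) (det m (minor X j)) (det p W)) ⟩
    cofactorTerm X j * det p W
      ∎
  rightTerm : ∀ j → cofactorTerm B (suc m ↑ʳ j) ≡ + 0
  rightTerm j = begin
    sign (toℕ (suc m ↑ʳ j)) * B zero (suc m ↑ʳ j) * det (m ℕ.+ p) (minor B (suc m ↑ʳ j))
      ≡⟨ cong (λ x → sign (toℕ (suc m ↑ʳ j)) * x * det (m ℕ.+ p) (minor B (suc m ↑ʳ j)))
              (block-↑ˡ-↑ʳ X O Z W zero j) ⟩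
    sign (toℕ (suc m ↑ʳ j)) * + 0 * det (m ℕ.+ p) (minor B (suc m ↑ʳ j))
      ≡⟨ cong (_* det (m ℕ.+ p) (minor B (suc m ↑ʳ j))) (ℤP.*-zeroʳ (sign (toℕ (suc m ↑ʳ j)))) ⟩
    + 0 * det (m ℕ.+ p) (minor B (suc m ↑ʳ j))
      ≡⟨ ℤP.*-zeroˡ (det (m ℕ.+ p) (minor B (suc m ↑ʳ j))) ⟩
    + 0
      ∎

inLeftHalf inRightHalf : ∀ {m p} → Fin m ⊎ Fin p → Bool
inLeftHalf (inj₁ _) = true
inLeftHalf (inj₂ _) = false
inRightHalf (inj₁ _) = false
inRightHalf (inj₂ _) = true

module _ (n : ℕ) (X Y Z W : Mat n) where

  private
    N : ℕ
    N = n ℕ.+ n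
    O : Mat n
    O _ _ = + 0
    M : Mat N
    M = block X Y Z W

  det-block-subtractLeftColumns :
    det N (block X Y Z W) ≡ det N (block X (λ i j → Y i j - X i j) Z (λ i j → W i j - Z i j))
  det-block-subtractLeftColumns =
    trans (sym (det-addColumnCombinations N M a (λ c → inRightHalf (splitAt n c)) a-source a-target))
          (det-cong N (λ r → ↑-elim (leftColumn r) (rightColumn r)))
    where
    a : Mat N
    a = block O O (λ j i → - + 1 * δ i j) O
    a-source : ∀ c d → inRightHalf (splitAt n d) ≡ true → a c d ≡ + 0
    a-source c d right with splitAt n c | splitAt n d
    ... | inj₁ _ | inj₂ _ = refl
    ... | inj₂ _ | inj₂ _ = refl
    a-target : ∀ c d → inRightHalf (splitAt n c) ≡ false → a c d ≡ + 0
    a-target c d left with splitAt n c | splitAt n d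
    ... | inj₁ _ | inj₁ _ = refl
    ... | inj₁ _ | inj₂ _ = refl
    Y′ W′ : Mat n
    Y′ i j = Y i j - X i j
    W′ i j = W i j - Z i j
    M′ : Mat N
    M′ = block X Y′ Z W′
    leftColumn : ∀ r j → M r (j ↑ˡ n) + sumℤ N (λ d → a (j ↑ˡ n) d * M r d) ≡ M′ r (j ↑ˡ n)
    leftColumn r j = begin
      M r (j ↑ˡ n) + sumℤ N (λ d → a (j ↑ˡ n) d * M r d)
        ≡⟨ cong (λ z → M r (j ↑ˡ n) + z) (sumℤ-zero N (λ d → trans (cong (_* M r d) (untouched d)) (ℤP.*-zeroˡ (M r d)))) ⟩
      M r (j ↑ˡ n) + + 0
        ≡⟨ ℤP.+-identityʳ _ ⟩
      M r (j ↑ˡ n)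
        ≡⟨ block-leftColumn r j ⟩
      M′ r (j ↑ˡ n)
        ∎
      where
      open ≡-Reasoning
      untouched : ∀ d → a (j ↑ˡ n) d ≡ + 0
      untouched d = a-target (j ↑ˡ n) d (cong inRightHalf (FinP.splitAt-↑ˡ n j n))
    rightColumn : ∀ r j → M r (n ↑ʳ j) + sumℤ N (λ d → a (n ↑ʳ j) d * M r d) ≡ M′ r (n ↑ʳ j)
    rightColumn r j = begin
      M r (n ↑ʳ j) + sumℤ N (λ d → a (n ↑ʳ j) d * M r d)
        ≡⟨ cong (λ z → M r (n ↑ʳ j) + z) (trans (sumℤ-↑ n n (λ d → a (n ↑ʳ j) d * M r d))
                                               (cong₂ _+_ (sumℤ-cong n fromLeft) (sumℤ-zero n fromRight))) ⟩
      M r (n ↑ʳ j) + (sumℤ n (λ i → - + 1 * (δ i j * M r (i ↑ˡ n))) + + 0)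
        ≡⟨ cong (λ z → M r (n ↑ʳ j) + (z + + 0))
                (trans (sumℤ-*ˡ n (- + 1) (λ i → δ i j * M r (i ↑ˡ n)))
                       (cong (- + 1 *_) (sumℤ-δ n j (λ i → M r (i ↑ˡ n))))) ⟩
      M r (n ↑ʳ j) + (- + 1 * M r (j ↑ˡ n) + + 0)
        ≡⟨ subtract (M r (n ↑ʳ j)) (M r (j ↑ˡ n)) ⟩
      M r (n ↑ʳ j) - M r (j ↑ˡ n)
        ≡⟨ ↑-elim {P = λ r → M r (n ↑ʳ j) - M r (j ↑ˡ n) ≡ M′ r (n ↑ʳ j)}
                  (λ i → trans (cong₂ _-_ (block-↑ˡ-↑ʳ X Y Z W i j) (block-↑ˡ-↑ˡ X Y Z W i j))
                               (sym (block-↑ˡ-↑ʳ X Y′ Z W′ i j)))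
                  (λ i → trans (cong₂ _-_ (block-↑ʳ-↑ʳ X Y Z W i j) (block-↑ʳ-↑ˡ X Y Z W i j))
                               (sym (block-↑ʳ-↑ʳ X Y′ Z W′ i j))) r ⟩
      M′ r (n ↑ʳ j)
        ∎
      where
      open ≡-Reasoning
      fromLeft : ∀ i → a (n ↑ʳ j) (i ↑ˡ n) * M r (i ↑ˡ n) ≡ - + 1 * (δ i j * M r (i ↑ˡ n))
      fromLeft i = trans (cong (_* M r (i ↑ˡ n)) (block-↑ʳ-↑ˡ O O (λ j i → - + 1 * δ i j) O j i))
                         (ℤP.*-assoc (- + 1) (δ i j) (M r (i ↑ˡ n)))
      fromRight : ∀ i → a (n ↑ʳ j) (n ↑ʳ i) * M r (n ↑ʳ i) ≡ + 0
      fromRight i = trans (cong (_* M r (n ↑ʳ i)) (block-↑ʳ-↑ʳ O O (λ j i → - + 1 * δ i j) O j i))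
                          (ℤP.*-zeroˡ (M r (n ↑ʳ i)))
      subtract : ∀ y x → y + (- + 1 * x + + 0) ≡ y - x
      subtract = solve-∀

  det-block-addBottomRows :
    det N (block X Y Z W) ≡ det N (block (λ i j → X i j + Z i j) (λ i j → Y i j + W i j) Z W)
  det-block-addBottomRows =
    trans (sym (det-addRowCombinations N M a (λ r → inLeftHalf (splitAt n r)) a-source a-target))
          (det-cong N (↑-elim topRow bottomRow))
    where
    a : Mat N
    a = block O (λ i j → δ j i) O O
    a-source : ∀ r d → inLeftHalf (splitAt n d) ≡ true → a r d ≡ + 0
    a-source r d top with splitAt n r | splitAt n d
    ... | inj₁ _ | inj₁ _ = refl
    ... | inj₂ _ | inj₁ _ = refl
    a-target : ∀ r d → inLeftHalf (splitAt n r) ≡ false → a r d ≡ + 0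
    a-target r d bottom with splitAt n r | splitAt n d
    ... | inj₂ _ | inj₁ _ = refl
    ... | inj₂ _ | inj₂ _ = refl
    X′ Y′ : Mat n
    X′ i j = X i j + Z i j
    Y′ i j = Y i j + W i j
    M′ : Mat N
    M′ = block X′ Y′ Z W
    topRow : ∀ i c → M (i ↑ˡ n) c + sumℤ N (λ d → a (i ↑ˡ n) d * M d c) ≡ M′ (i ↑ˡ n) c
    topRow i c = begin
      M (i ↑ˡ n) c + sumℤ N (λ d → a (i ↑ˡ n) d * M d c)
        ≡⟨ cong (λ z → M (i ↑ˡ n) c + z) (trans (sumℤ-↑ n n (λ d → a (i ↑ˡ n) d * M d c))
                                               (cong₂ _+_ (sumℤ-zero n fromTop) (sumℤ-cong n fromBottom))) ⟩
      M (i ↑ˡ n) c + (+ 0 + sumℤ n (λ j → δ j i * M (n ↑ʳ j) c))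
        ≡⟨ cong (λ z → M (i ↑ˡ n) c + z) (trans (ℤP.+-identityˡ _) (sumℤ-δ n i (λ j → M (n ↑ʳ j) c))) ⟩
      M (i ↑ˡ n) c + M (n ↑ʳ i) c
        ≡⟨ ↑-elim {P = λ c → M (i ↑ˡ n) c + M (n ↑ʳ i) c ≡ M′ (i ↑ˡ n) c}
                  (λ j → trans (cong₂ _+_ (block-↑ˡ-↑ˡ X Y Z W i j) (block-↑ʳ-↑ˡ X Y Z W i j))
                               (sym (block-↑ˡ-↑ˡ X′ Y′ Z W i j)))
                  (λ j → trans (cong₂ _+_ (block-↑ˡ-↑ʳ X Y Z W i j) (block-↑ʳ-↑ʳ X Y Z W i j))
                               (sym (block-↑ˡ-↑ʳ X′ Y′ Z W i j))) c ⟩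
      M′ (i ↑ˡ n) c
        ∎
      where
      open ≡-Reasoning
      fromTop : ∀ j → a (i ↑ˡ n) (j ↑ˡ n) * M (j ↑ˡ n) c ≡ + 0
      fromTop j = trans (cong (_* M (j ↑ˡ n) c) (block-↑ˡ-↑ˡ O (λ i j → δ j i) O O i j))
                        (ℤP.*-zeroˡ (M (j ↑ˡ n) c))
      fromBottom : ∀ j → a (i ↑ˡ n) (n ↑ʳ j) * M (n ↑ʳ j) c ≡ δ j i * M (n ↑ʳ j) c
      fromBottom j = cong (_* M (n ↑ʳ j) c) (block-↑ˡ-↑ʳ O (λ i j → δ j i) O O i j)
    bottomRow : ∀ i c → M (n ↑ʳ i) c + sumℤ N (λ d → a (n ↑ʳ i) d * M d c) ≡ M′ (n ↑ʳ i) c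
    bottomRow i c = begin
      M (n ↑ʳ i) c + sumℤ N (λ d → a (n ↑ʳ i) d * M d c)
        ≡⟨ cong (λ z → M (n ↑ʳ i) c + z) (sumℤ-zero N (λ d → trans (cong (_* M d c) (untouched d)) (ℤP.*-zeroˡ (M d c)))) ⟩
      M (n ↑ʳ i) c + + 0
        ≡⟨ ℤP.+-identityʳ _ ⟩
      M (n ↑ʳ i) c
        ≡⟨ block-bottomRow i c ⟩
      M′ (n ↑ʳ i) c
        ∎
      where
      open ≡-Reasoning
      untouched : ∀ d → a (n ↑ʳ i) d ≡ + 0
      untouched d = a-target (n ↑ʳ i) d (cong inLeftHalf (FinP.splitAt-↑ʳ n n i))

det-block-symmetric : ∀ n (P Q : Mat n) →
  det (n ℕ.+ n) (block P Q Q P) ≡ det n (λ i j → P i j + Q i j) * det n (λ i j → P i j - Q i j)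
det-block-symmetric n P Q = begin
  det (n ℕ.+ n) (block P Q Q P)
    ≡⟨ det-block-subtractLeftColumns n P Q Q P ⟩
  det (n ℕ.+ n) (block P (λ i j → Q i j - P i j) Q (λ i j → P i j - Q i j))
    ≡⟨ det-block-addBottomRows n P (λ i j → Q i j - P i j) Q (λ i j → P i j - Q i j) ⟩
  det (n ℕ.+ n) (block (λ i j → P i j + Q i j) (λ i j → Q i j - P i j + (P i j - Q i j)) Q (λ i j → P i j - Q i j))
    ≡⟨ det-cong (n ℕ.+ n) (block-cong (λ _ _ → refl) (λ i j → cancel (P i j) (Q i j)) (λ _ _ → refl) (λ _ _ → refl)) ⟩
  det (n ℕ.+ n) (block (λ i j → P i j + Q i j) (λ _ _ → + 0) Q (λ i j → P i j - Q i j))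
    ≡⟨ det-blockLowerTriangular n n (λ i j → P i j + Q i j) Q (λ i j → P i j - Q i j) ⟩
  det n (λ i j → P i j + Q i j) * det n (λ i j → P i j - Q i j)
    ∎
  where
  open ≡-Reasoning
  cancel : ∀ p q → q - p + (p - q) ≡ + 0
  cancel = solve-∀

det-constantRowSums : ∀ m (X : Mat (suc m)) (μ : ℤ) → (∀ r → sumℤ (suc m) (X r) ≡ μ) →
  det (suc m) X ≡ μ * det (suc m) (consCol (λ _ → + 1) (λ r e → X r (suc e)))
det-constantRowSums m X μ rowSum = begin
  det (suc m) X
    ≡⟨ det-cong (suc m) asConsCol ⟩
  det (suc m) (consCol (λ r → X r zero) tail)
    ≡⟨ sym (det-consCol-addCols m (λ r → X r zero) (λ _ → + 1) tail) ⟩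
  det (suc m) (consCol (λ r → X r zero + sumℤ m (λ e → + 1 * X r (suc e))) tail)
    ≡⟨ det-cong (suc m) (consCol-cong tail rowTotal) ⟩
  det (suc m) (consCol (λ _ → μ * + 1) tail)
    ≡⟨ det-consCol-* m μ (λ _ → + 1) tail ⟩
  μ * det (suc m) (consCol (λ _ → + 1) tail)
    ∎
  where
  open ≡-Reasoning
  tail : Fin (suc m) → Fin m → ℤ
  tail r e = X r (suc e)
  asConsCol : ∀ r c → X r c ≡ consCol (λ r → X r zero) tail r c
  asConsCol r zero    = refl
  asConsCol r (suc c) = refl
  rowTotal : ∀ r → X r zero + sumℤ m (λ e → + 1 * X r (suc e)) ≡ μ * + 1
  rowTotal r = begin
    X r zero + sumℤ m (λ e → + 1 * X r (suc e)) ≡⟨ cong (λ z → X r zero + z) (sumℤ-cong m (λ e → ℤP.*-identityˡ (X r (suc e)))) ⟩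
    sumℤ (suc m) (X r)                           ≡⟨ rowSum r ⟩
    μ                                            ≡⟨ sym (ℤP.*-identityʳ μ) ⟩
    μ * + 1                                      ∎

det-consCol-ones-shift : ∀ m (B : Fin (suc m) → Fin m → ℤ) (c : ℤ) →
  det (suc m) (consCol (λ _ → + 1) (λ r e → B r e + c)) ≡ det (suc m) (consCol (λ _ → + 1) B)
det-consCol-ones-shift m B c =
  trans (det-cong (suc m) shifted)
        (det-addColumnCombinations (suc m) (consCol (λ _ → + 1) B) a isSuc a-source a-target)
  where
  a : Fin (suc m) → Fin (suc m) → ℤ
  a (suc _) zero    = c
  a _       _       = + 0
  isSuc : Fin (suc m) → Bool
  isSuc zero    = false
  isSuc (suc _) = true
  a-source : ∀ k d → isSuc d ≡ true → a k d ≡ + 0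
  a-source zero    d       _ = refl
  a-source (suc k) (suc d) _ = refl
  a-target : ∀ k d → isSuc k ≡ false → a k d ≡ + 0
  a-target zero d _ = refl
  shifted : ∀ r k → consCol (λ _ → + 1) (λ r e → B r e + c) r k
                  ≡ consCol (λ _ → + 1) B r k + sumℤ (suc m) (λ d → a k d * consCol (λ _ → + 1) B r d)
  shifted r zero    = sym (cong (λ z → + 1 + z) (sumℤ-zero (suc m) (λ d → ℤP.*-zeroˡ (consCol (λ _ → + 1) B r d))))
  shifted r (suc e) = cong (λ z → B r e + z) (sym (trans (cong (λ z → c * + 1 + z) (sumℤ-zero m (λ d → ℤP.*-zeroˡ (B r d))))
                                                         (trans (ℤP.+-identityʳ (c * + 1)) (ℤP.*-identityʳ c))))

det-addConstant : ∀ m (M : Mat m) (μ c : ℤ) → (∀ r → sumℤ m (M r) ≡ μ) →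
  det m (λ r j → M r j + c) * μ ≡ (μ + c * + m) * det m M
det-addConstant zero    M μ c _      = ring μ c
  where ring : ∀ μ c → + 1 * μ ≡ (μ + c * + 0) * + 1
        ring = solve-∀
det-addConstant (suc m) M μ c rowSum = begin
  det (suc m) (λ r j → M r j + c) * μ
    ≡⟨ cong (_* μ) (det-constantRowSums m (λ r j → M r j + c) (μ + c * + suc m) shiftedRowSum) ⟩
  (μ + c * + suc m) * det (suc m) (consCol (λ _ → + 1) (λ r e → M r (suc e) + c)) * μ
    ≡⟨ cong (λ z → (μ + c * + suc m) * z * μ) (det-consCol-ones-shift m (λ r e → M r (suc e)) c) ⟩
  (μ + c * + suc m) * D₁ * μ
    ≡⟨ ring (μ + c * + suc m) μ D₁ ⟩
  (μ + c * + suc m) * (μ * D₁)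
    ≡⟨ cong ((μ + c * + suc m) *_) (sym (det-constantRowSums m M μ rowSum)) ⟩
  (μ + c * + suc m) * det (suc m) M
    ∎
  where
  open ≡-Reasoning
  D₁ : ℤ
  D₁ = det (suc m) (consCol (λ _ → + 1) (λ r e → M r (suc e)))
  shiftedRowSum : ∀ r → sumℤ (suc m) (λ j → M r j + c) ≡ μ + c * + suc m
  shiftedRowSum r = trans (sumℤ-distrib-+ (suc m) (M r) (λ _ → c)) (cong₂ _+_ (rowSum r) (sumℤ-const (suc m) c))
  ring : ∀ a μ d → a * d * μ ≡ a * (μ * d)
  ring = solve-∀

∨-true : ∀ x {y} → x ∨ y ≡ true → x ≡ true ⊎ y ≡ true
∨-true true  _ = inj₁ refl
∨-true false e = inj₂ e

∧-true : ∀ x {y} → x ∧ y ≡ true → x ≡ true × y ≡ true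
∧-true true e = refl , e

anyFin-false : ∀ m (f : Fin m → Bool) → (∀ w → f w ≡ false) → anyFin m f ≡ false
anyFin-false zero    f none = refl
anyFin-false (suc m) f none = cong₂ _∨_ (none zero) (anyFin-false m (λ i → f (suc i)) (λ i → none (suc i)))

anyFin-true : ∀ m (f : Fin m → Bool) w → f w ≡ true → anyFin m f ≡ true
anyFin-true (suc m) f zero    e = cong (_∨ anyFin m (λ i → f (suc i))) e
anyFin-true (suc m) f (suc w) e =
  trans (cong (f zero ∨_) (anyFin-true m (λ i → f (suc i)) w e)) (BoolP.∨-zeroʳ (f zero))

anyFin-witness : ∀ m (f : Fin m → Bool) → anyFin m f ≡ true → ∃[ w ] f w ≡ true
anyFin-witness (suc m) f e with ∨-true (f zero) e
... | inj₁ e₀ = zero , e₀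
... | inj₂ e₁ with anyFin-witness m (λ i → f (suc i)) e₁
...   | w , e_w = suc w , e_w

sumℕ-indicator≤ : ∀ N (f : Fin N → Bool) → sumℕ N (λ d → if f d then 0 else 1) ℕ.≤ N
sumℕ-indicator≤ zero    f = z≤n
sumℕ-indicator≤ (suc N) f with f zero
... | true  = ℕP.m≤n⇒m≤1+n (sumℕ-indicator≤ N (λ i → f (suc i)))
... | false = s≤s (sumℕ-indicator≤ N (λ i → f (suc i)))

sumℕ-indicator≥ : ∀ N D (f : ℕ → Bool) → D ℕ.≤ N → (∀ d → d ℕ.< D → f d ≡ false) →
  D ℕ.≤ sumℕ N (λ d → if f (toℕ d) then 0 else 1)
sumℕ-indicator≥ N       zero    f _         _     = z≤n
sumℕ-indicator≥ (suc N) (suc D) f (s≤s D≤N) below rewrite below 0 (s≤s z≤n) =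
  s≤s (sumℕ-indicator≥ N D (λ d → f (suc d)) D≤N (λ d d<D → below (suc d) (s≤s d<D)))

sumℕ-indicator-threshold : ∀ N D (f : ℕ → Bool) → D ℕ.≤ N →
  (∀ d → d ℕ.< D → f d ≡ false) → (∀ d → D ℕ.≤ d → f d ≡ true) →
  sumℕ N (λ d → if f (toℕ d) then 0 else 1) ≡ D
sumℕ-indicator-threshold zero    .zero   f z≤n       below above = refl
sumℕ-indicator-threshold (suc N) zero    f _         below above rewrite above 0 z≤n =
  sumℕ-indicator-threshold N zero (λ d → f (suc d)) z≤n (λ _ ()) (λ d _ → above (suc d) z≤n)
sumℕ-indicator-threshold (suc N) (suc D) f (s≤s D≤N) below above rewrite below 0 (s≤s z≤n) =
  cong suc (sumℕ-indicator-threshold N D (λ d → f (suc d)) D≤N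
             (λ d d<D → below (suc d) (s≤s d<D)) (λ d D≤d → above (suc d) (s≤s D≤d)))

closedAdj : ∀ {n} → Graph n → Fin n → Fin n → Bool
closedAdj G r t = ⌊ r ≟ t ⌋ ∨ G r t

Bool-clash : ∀ {b} → b ≡ true → b ≡ false → ⊥
Bool-clash refl ()

module _ {n : ℕ} (G : Graph n) where

  Reach-suc : ∀ d u v → Reach G d u v ≡ true → Reach G (suc d) u v ≡ true
  Reach-suc d u v e = cong (_∨ anyFin n (λ w → G u w ∧ Reach G d w v)) e

  Reach-mono : ∀ {D d} u v → D ℕ.≤′ d → Reach G D u v ≡ true → Reach G d u v ≡ true
  Reach-mono u v (ℕ.≤′-reflexive refl)        e = e
  Reach-mono {d = suc d} u v (ℕ.≤′-step D≤′d) e = Reach-suc d u v (Reach-mono u v D≤′d e)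

  Reach-step : ∀ d u w v → G u w ≡ true → Reach G d w v ≡ true → Reach G (suc d) u v ≡ true
  Reach-step d u w v uw vw = trans (cong (Reach G d u v ∨_) (anyFin-true n _ w (cong₂ _∧_ uw vw)))
                                  (BoolP.∨-zeroʳ (Reach G d u v))

  Reach-edge : ∀ u v → G u v ≡ true → Reach G 1 u v ≡ true
  Reach-edge u v uv = Reach-step 0 u v v uv (≟-refl v)

  Reach-1-closedAdj : ∀ u v → Reach G 1 u v ≡ true → closedAdj G u v ≡ true
  Reach-1-closedAdj u v reached with ∨-true ⌊ u ≟ v ⌋ reached
  ... | inj₁ u≡v    = cong (_∨ G u v) u≡v
  ... | inj₂ viaOne with anyFin-witness n _ viaOne
  ...   | w , e_w with ∧-true (G u w) e_w
  ...     | uw , w≡v with ≟-true {i = w} w≡v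
  ...       | refl = trans (cong (⌊ u ≟ w ⌋ ∨_) uw) (BoolP.∨-zeroʳ ⌊ u ≟ w ⌋)

  Reach-1-false : ∀ u v → u ≢ v → G u v ≡ false → Reach G 1 u v ≡ false
  Reach-1-false u v u≢v uv = cong₂ _∨_ (≟-≢ u≢v) (anyFin-false n _ notThrough)
    where notThrough : ∀ w → (G u w ∧ ⌊ w ≟ v ⌋) ≡ false
          notThrough w with w ≟ v
          ... | yes refl = cong (_∧ true) uv
          ... | no _     = BoolP.∧-zeroʳ (G u w)

  Reach-2-false : ∀ u v → Reach G 1 u v ≡ false → (∀ w → G u w ≡ true → Reach G 1 w v ≡ false) →
    Reach G 2 u v ≡ false
  Reach-2-false u v unreached₁ viaNeighbour = cong₂ _∨_ unreached₁ (anyFin-false n _ notThrough)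
    where notThrough : ∀ w → (G u w ∧ Reach G 1 w v) ≡ false
          notThrough w with G u w in uw
          ... | true  = viaNeighbour w uw
          ... | false = refl

  Reach-isolated : ∀ u v → u ≢ v → (∀ w → G u w ≡ false) → ∀ d → Reach G d u v ≡ false
  Reach-isolated u v u≢v isolated zero    = ≟-≢ u≢v
  Reach-isolated u v u≢v isolated (suc d) =
    cong₂ _∨_ (Reach-isolated u v u≢v isolated d)
              (anyFin-false n _ (λ w → cong (_∧ Reach G d w v) (isolated w)))

  dist-≡ : ∀ u v D → D ℕ.≤ n → (∀ d → d ℕ.< D → Reach G d u v ≡ false) → Reach G D u v ≡ true →
    dist G u v ≡ D
  dist-≡ u v D D≤n below reached =
    sumℕ-indicator-threshold n D (λ d → Reach G d u v) D≤n below
      (λ d D≤d → Reach-mono u v (ℕP.≤⇒≤′ D≤d) reached)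

  dist-refl : ∀ u → dist G u u ≡ 0
  dist-refl u = dist-≡ u u 0 z≤n (λ _ ()) (≟-refl u)

  Reach-of-dist≤ : ∀ u v D → D ℕ.< n → dist G u v ℕ.≤ D → Reach G D u v ≡ true
  Reach-of-dist≤ u v D D<n dist≤D with Reach G D u v in unreached
  ... | true  = refl
  ... | false =
    ⊥-elim (ℕP.<-irrefl refl (ℕP.≤-trans (sumℕ-indicator≥ n (suc D) (λ d → Reach G d u v) D<n below) dist≤D))
    where below : ∀ d → d ℕ.< suc D → Reach G d u v ≡ false
          below d d<1+D with Reach G d u v in reached
          ... | false = refl
          ... | true  = trans (sym (Reach-mono u v (ℕP.≤⇒≤′ (ℕP.m<1+n⇒m≤n d<1+D)) reached)) unreached

Fin2-noThird : ∀ (u v w : Fin 2) → u ≢ v → w ≢ u → w ≢ v → ⊥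
Fin2-noThird zero       zero       _          u≢v _   _   = u≢v refl
Fin2-noThird (suc zero) (suc zero) _          u≢v _   _   = u≢v refl
Fin2-noThird zero       (suc zero) zero       _   w≢u _   = w≢u refl
Fin2-noThird zero       (suc zero) (suc zero) _   _   w≢v = w≢v refl
Fin2-noThird (suc zero) zero       zero       _   _   w≢v = w≢v refl
Fin2-noThird (suc zero) zero       (suc zero) _   w≢u _   = w≢u refl

module DiameterTwo {n : ℕ} (G : Graph n) (simple : IsSimple G) (connected : Connected G) (diam₂ : Diameter2 G) where

  closedAdj-refl : ∀ a → closedAdj G a a ≡ true
  closedAdj-refl a = cong (_∨ G a a) (≟-refl a)

  closedAdj-sym : ∀ a b → closedAdj G a b ≡ closedAdj G b a
  closedAdj-sym a b = cong₂ _∨_ (≟-sym a b) (proj₁ simple a b)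

  2≤n : 2 ℕ.≤ n
  2≤n with proj₂ diam₂
  ... | u , v , dist≡2 = subst (ℕ._≤ n) dist≡2 (sumℕ-indicator≤ n (λ d → Reach G (toℕ d) u v))

  -- dist only inspects walk lengths below n, so dist ≤ 2 yields a walk of length 2 only when n ≥ 3.
  -- On two vertices, distance 2 would mean two non-adjacent vertices, contradicting connectivity.
  n≢2 : n ≢ 2
  n≢2 refl with proj₂ diam₂
  ... | u , v , dist≡2 with Reach G 0 u v in unreached₀ | Reach G 1 u v in unreached₁
  ...   | false | false =
    ⊥-elim (Bool-clash (proj₂ (connected u v)) (Reach-isolated G u v u≢v isolated (proj₁ (connected u v))))
    where
    u≢v : u ≢ v
    u≢v refl = Bool-clash (≟-refl u) unreached₀
    uv : G u v ≡ false
    -- The type of unreached₁ has Reach G 0 u v already replaced by false.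
    uv with G u v in e
    ... | true  = ⊥-elim (Bool-clash (anyFin-true 2 (λ w → G u w ∧ ⌊ w ≟ v ⌋) v (cong₂ _∧_ e (≟-refl v)))
                                     unreached₁)
    ... | false = refl
    isolated : ∀ w → G u w ≡ false
    isolated w with G u w in e
    ... | false = refl
    ... | true  = ⊥-elim (Fin2-noThird u v w u≢v (λ { refl → Bool-clash e (proj₂ simple u) })
                                                (λ { refl → Bool-clash e uv }))
  n≢2 refl | u , v , () | true  | true
  n≢2 refl | u , v , () | true  | false
  n≢2 refl | u , v , () | false | true

  3≤n : 3 ℕ.≤ n
  3≤n with ℕP.m≤n⇒m<n∨m≡n 2≤n
  ... | inj₁ 2<n = 2<n
  ... | inj₂ 2≡n = ⊥-elim (n≢2 (sym 2≡n))

  commonClosedNeighbour : ∀ a b → ∃[ s ] (closedAdj G a s ≡ true × closedAdj G b s ≡ true)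
  commonClosedNeighbour a b with ∨-true (Reach G 1 a b) (Reach-of-dist≤ G a b 2 3≤n (proj₁ diam₂ a b))
  ... | inj₁ reached₁ = b , Reach-1-closedAdj G a b reached₁ , closedAdj-refl b
  ... | inj₂ viaTwo with anyFin-witness n _ viaTwo
  ...   | w , e_w with ∧-true (G a w) e_w
  ...     | aw , reached₁ = w , trans (cong (⌊ a ≟ w ⌋ ∨_) aw) (BoolP.∨-zeroʳ ⌊ a ≟ w ⌋)
                              , trans (closedAdj-sym b w) (Reach-1-closedAdj G w b reached₁)

module _ {n : ℕ} (G : Graph n) where

  EDC-↑ˡ-↑ˡ : ∀ a b → EDC G (a ↑ˡ n) (b ↑ˡ n) ≡ false
  EDC-↑ˡ-↑ˡ a b rewrite FinP.splitAt-↑ˡ n a n | FinP.splitAt-↑ˡ n b n = refl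

  EDC-↑ˡ-↑ʳ : ∀ a b → EDC G (a ↑ˡ n) (n ↑ʳ b) ≡ closedAdj G a b
  EDC-↑ˡ-↑ʳ a b rewrite FinP.splitAt-↑ˡ n a n | FinP.splitAt-↑ʳ n n b = refl

  EDC-↑ʳ-↑ˡ : ∀ a b → EDC G (n ↑ʳ b) (a ↑ˡ n) ≡ closedAdj G a b
  EDC-↑ʳ-↑ˡ a b rewrite FinP.splitAt-↑ˡ n a n | FinP.splitAt-↑ʳ n n b = refl

  EDC-↑ʳ-↑ʳ : ∀ a b → EDC G (n ↑ʳ a) (n ↑ʳ b) ≡ false
  EDC-↑ʳ-↑ʳ a b rewrite FinP.splitAt-↑ʳ n n a | FinP.splitAt-↑ʳ n n b = refl

  seidelEntry : ∀ (x : ℤ) i j {e D} → δ i j ≡ e → dist (EDC G) i j ≡ D →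
    x * δ i j - distSeidel (EDC G) i j ≡ x * e - ((+ 1 - e) - + 2 * + D)
  seidelEntry x i j refl refl = refl

  closedAdj-δ+adj : IsSimple G → ∀ a b → closedAdj G a b ≡ true → δ a b + adjMat G a b ≡ + 1
  closedAdj-δ+adj simple a b adj with a ≟ b
  ... | yes refl = cong (λ e → + 1 + (if e then + 1 else + 0)) (proj₂ simple a)
  ... | no _     = cong (λ e → + 0 + (if e then + 1 else + 0)) adj

  ¬closedAdj-δ+adj : ∀ a b → closedAdj G a b ≡ false → δ a b + adjMat G a b ≡ + 0
  ¬closedAdj-δ+adj a b far = cong₂ (λ e e′ → (if e then + 1 else + 0) + (if e′ then + 1 else + 0))
                                   (BoolP.∨-conicalˡ ⌊ a ≟ b ⌋ (G a b) far) (BoolP.∨-conicalʳ ⌊ a ≟ b ⌋ (G a b) far)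

sameSideBlock : ∀ {n} → ℤ → Mat n
sameSideBlock x a b = x * δ a b - (+ 3 * δ a b - + 3)

crossBlock : ∀ {n} → Graph n → Mat n
crossBlock G a b = + 5 - + 4 * (δ a b + adjMat G a b)

-- Stated for a pair of embeddings ι, κ of the two sides, so that it serves for (v, u) and for (u, v).
module CoverSides {n : ℕ} (G : Graph n) (simple : IsSimple G) (connected : Connected G) (diam₂ : Diameter2 G)
  (ι κ : Fin n → Fin (n ℕ.+ n))
  (ι-injective : ∀ a b → ι a ≡ ι b → a ≡ b) (κ-injective : ∀ a b → κ a ≡ κ b → a ≡ b) (ι≢κ : ∀ a b → ι a ≢ κ b)
  (cover : ∀ {P : Fin (n ℕ.+ n) → Set} → (∀ a → P (ι a)) → (∀ b → P (κ b)) → ∀ c → P c)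
  (EDC-ιι : ∀ a b → EDC G (ι a) (ι b) ≡ false) (EDC-κκ : ∀ a b → EDC G (κ a) (κ b) ≡ false)
  (EDC-ικ : ∀ a b → EDC G (ι a) (κ b) ≡ closedAdj G a b) (EDC-κι : ∀ a b → EDC G (κ b) (ι a) ≡ closedAdj G a b)
  where

  open DiameterTwo G simple connected diam₂

  private
    H : Graph (n ℕ.+ n)
    H = EDC G

  3≤n+n : 3 ℕ.≤ n ℕ.+ n
  3≤n+n = ℕP.≤-trans 3≤n (ℕP.m≤m+n n n)

  reach₂-ιι : ∀ a b → Reach H 2 (ι a) (ι b) ≡ true
  reach₂-ιι a b with commonClosedNeighbour a b
  ... | s , as , bs = Reach-step H 1 (ι a) (κ s) (ι b) (trans (EDC-ικ a s) as)
                        (Reach-edge H (κ s) (ι b) (trans (EDC-κι b s) bs))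

  reach₂-κκ : ∀ a b → Reach H 2 (κ a) (κ b) ≡ true
  reach₂-κκ a b with commonClosedNeighbour a b
  ... | s , as , bs = Reach-step H 1 (κ a) (ι s) (κ b) (trans (EDC-κι s a) (trans (closedAdj-sym s a) as))
                        (Reach-edge H (ι s) (κ b) (trans (EDC-ικ s b) (trans (closedAdj-sym s b) bs)))

  dist-ιι : ∀ a b → a ≢ b → dist H (ι a) (ι b) ≡ 2
  dist-ιι a b a≢b = dist-≡ H (ι a) (ι b) 2 (ℕP.≤-trans (ℕP.n≤1+n 2) 3≤n+n) below (reach₂-ιι a b)
    where below : ∀ d → d ℕ.< 2 → Reach H d (ι a) (ι b) ≡ false
          below 0 _ = ≟-≢ (a≢b ∘ ι-injective a b)
          below 1 _ = Reach-1-false H (ι a) (ι b) (a≢b ∘ ι-injective a b) (EDC-ιι a b)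
          below (suc (suc _)) (s≤s (s≤s ()))

  dist-ικ-near : ∀ a b → closedAdj G a b ≡ true → dist H (ι a) (κ b) ≡ 1
  dist-ικ-near a b near = dist-≡ H (ι a) (κ b) 1 (ℕP.≤-trans (s≤s z≤n) 3≤n+n) below
                            (Reach-edge H (ι a) (κ b) (trans (EDC-ικ a b) near))
    where below : ∀ d → d ℕ.< 1 → Reach H d (ι a) (κ b) ≡ false
          below 0       _         = ≟-≢ (ι≢κ a b)
          below (suc _) (s≤s ())

  -- Every neighbour of ι a is some κ c with c ≠ b, and κ c is not adjacent to κ b.
  dist-ικ-far : ∀ a b → closedAdj G a b ≡ false → dist H (ι a) (κ b) ≡ 3
  dist-ικ-far a b far = dist-≡ H (ι a) (κ b) 3 3≤n+n below
                          (Reach-step H 2 (ι a) (κ a) (κ b) (trans (EDC-ικ a a) (closedAdj-refl a)) (reach₂-κκ a b))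
    where
    unreached₁ : Reach H 1 (ι a) (κ b) ≡ false
    unreached₁ = Reach-1-false H (ι a) (κ b) (ι≢κ a b) (trans (EDC-ικ a b) far)
    viaNeighbour : ∀ w → H (ι a) w ≡ true → Reach H 1 w (κ b) ≡ false
    viaNeighbour = cover {P = λ w → H (ι a) w ≡ true → Reach H 1 w (κ b) ≡ false}
      (λ c adj → ⊥-elim (Bool-clash adj (EDC-ιι a c)))
      (λ c adj → Reach-1-false H (κ c) (κ b) (λ κc≡κb → c≢b (κ-injective c b κc≡κb) adj) (EDC-κκ c b))
      where c≢b : ∀ {c} → c ≡ b → H (ι a) (κ c) ≡ true → ⊥
            c≢b refl adj = Bool-clash (trans (sym (EDC-ικ a b)) adj) far
    below : ∀ d → d ℕ.< 3 → Reach H d (ι a) (κ b) ≡ false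
    below 0 _ = ≟-≢ (ι≢κ a b)
    below 1 _ = unreached₁
    below 2 _ = Reach-2-false H (ι a) (κ b) unreached₁ viaNeighbour
    below (suc (suc (suc _))) (s≤s (s≤s (s≤s ())))

  charEntry-ιι : ∀ x a b → x * δ (ι a) (ι b) - distSeidel H (ι a) (ι b) ≡ sameSideBlock x a b
  charEntry-ιι x a b with a ≟ b
  ... | yes refl = trans (seidelEntry G x (ι a) (ι a) (δ-refl (ι a)) (dist-refl H (ι a))) (diagonal x)
    where diagonal : ∀ x → x * + 1 - ((+ 1 - + 1) - + 2 * + 0) ≡ x * + 1 - (+ 3 * + 1 - + 3)
          diagonal = solve-∀
  ... | no a≢b   = trans (seidelEntry G x (ι a) (ι b) (δ-≢ (a≢b ∘ ι-injective a b)) (dist-ιι a b a≢b)) (offDiagonal x)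
    where offDiagonal : ∀ x → x * + 0 - ((+ 1 - + 0) - + 2 * + 2) ≡ x * + 0 - (+ 3 * + 0 - + 3)
          offDiagonal = solve-∀

  charEntry-ικ : ∀ x a b → x * δ (ι a) (κ b) - distSeidel H (ι a) (κ b) ≡ crossBlock G a b
  charEntry-ικ x a b with closedAdj G a b in adj
  ... | true  = trans (seidelEntry G x (ι a) (κ b) (δ-≢ (ι≢κ a b)) (dist-ικ-near a b adj))
                      (trans (near x) (cong (λ z → + 5 - + 4 * z) (sym (closedAdj-δ+adj G simple a b adj))))
    where near : ∀ x → x * + 0 - ((+ 1 - + 0) - + 2 * + 1) ≡ + 5 - + 4 * + 1
          near = solve-∀
  ... | false = trans (seidelEntry G x (ι a) (κ b) (δ-≢ (ι≢κ a b)) (dist-ικ-far a b adj))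
                      (trans (far x) (cong (λ z → + 5 - + 4 * z) (sym (¬closedAdj-δ+adj G a b adj))))
    where far : ∀ x → x * + 0 - ((+ 1 - + 0) - + 2 * + 3) ≡ + 5 - + 4 * + 0
          far = solve-∀

charMatrix-EDC : ∀ {n} (G : Graph n) → IsSimple G → Connected G → Diameter2 G → ∀ x i j →
  x * δ i j - distSeidel (EDC G) i j ≡ block (sameSideBlock x) (crossBlock G) (crossBlock G) (sameSideBlock x) i j
charMatrix-EDC {n} G simple connected diam₂ x =
  ↑-elim (λ a → ↑-elim (λ b → trans (V.charEntry-ιι x a b) (sym (block-↑ˡ-↑ˡ P Q Q P a b)))
                       (λ b → trans (V.charEntry-ικ x a b) (sym (block-↑ˡ-↑ʳ P Q Q P a b))))
         (λ a → ↑-elim (λ b → trans (U.charEntry-ικ x a b) (sym (block-↑ʳ-↑ˡ P Q Q P a b)))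
                       (λ b → trans (U.charEntry-ιι x a b) (sym (block-↑ʳ-↑ʳ P Q Q P a b))))
  where
  P Q : Mat n
  P = sameSideBlock x
  Q = crossBlock G
  open DiameterTwo G simple connected diam₂ using (closedAdj-sym)
  module V = CoverSides G simple connected diam₂ (_↑ˡ n) (n ↑ʳ_)
    (FinP.↑ˡ-injective n) (FinP.↑ʳ-injective n) ↑ˡ≢↑ʳ ↑-elim
    (EDC-↑ˡ-↑ˡ G) (EDC-↑ʳ-↑ʳ G) (EDC-↑ˡ-↑ʳ G) (EDC-↑ʳ-↑ˡ G)
  module U = CoverSides G simple connected diam₂ (n ↑ʳ_) (_↑ˡ n)
    (FinP.↑ʳ-injective n) (FinP.↑ˡ-injective n) (λ a b eq → ↑ˡ≢↑ʳ b a (sym eq)) (λ right left → ↑-elim left right)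
    (EDC-↑ʳ-↑ʳ G) (EDC-↑ˡ-↑ˡ G)
    (λ a b → trans (EDC-↑ʳ-↑ˡ G b a) (closedAdj-sym b a)) (λ a b → trans (EDC-↑ˡ-↑ʳ G b a) (closedAdj-sym b a))

adjMat-rowSum : ∀ {n} (G : Graph n) k → Regular G k → ∀ a → sumℤ n (adjMat G a) ≡ + k
adjMat-rowSum {n} G k regular a =
  trans (sumℤ-cong n (λ b → asℕ (G a b))) (trans (sumℤ-+ n (λ b → if G a b then 1 else 0)) (cong +_ (regular a)))
  where asℕ : ∀ e → (if e then + 1 else + 0) ≡ + (if e then 1 else 0)
        asℕ true  = refl
        asℕ false = refl

rowSum-δ-adjMat : ∀ {n} (G : Graph n) k → Regular G k → ∀ (α β : ℤ) a →
  sumℤ n (λ b → α * δ a b + β * adjMat G a b) ≡ α + β * + k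
rowSum-δ-adjMat {n} G k regular α β a = begin
  sumℤ n (λ b → α * δ a b + β * adjMat G a b)
    ≡⟨ sumℤ-distrib-+ n (λ b → α * δ a b) (λ b → β * adjMat G a b) ⟩
  sumℤ n (λ b → α * δ a b) + sumℤ n (λ b → β * adjMat G a b)
    ≡⟨ cong₂ _+_ (sumℤ-*ˡ n α (δ a)) (sumℤ-*ˡ n β (adjMat G a)) ⟩
  α * sumℤ n (δ a) + β * sumℤ n (adjMat G a)
    ≡⟨ cong₂ (λ s t → α * s + β * t) sumδ (adjMat-rowSum G k regular a) ⟩
  α * + 1 + β * + k
    ≡⟨ cong (_+ β * + k) (ℤP.*-identityʳ α) ⟩
  α + β * + k
    ∎
  where
  open ≡-Reasoning
  sumδ : sumℤ n (δ a) ≡ + 1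
  sumδ = trans (sumℤ-cong n (λ b → trans (δ-sym a b) (sym (ℤP.*-identityʳ (δ b a))))) (sumℤ-δ n a (λ _ → + 1))

charPoly-sumBlock : ∀ {n} (G : Graph n) k → Regular G k → ∀ x →
  det n (λ a b → sameSideBlock x a b + crossBlock G a b) * (x - (+ 7 + + 4 * + k))
    ≡ (x - (- (+ 8 * + n) + + 4 * + k + + 7)) * charPoly (λ a b → + 7 * δ a b + + 4 * adjMat G a b) x
charPoly-sumBlock {n} G k regular x =
  trans (cong (_* (x - (+ 7 + + 4 * + k))) (det-cong n (λ a b → shift x (δ a b) (adjMat G a b))))
   (trans (det-addConstant n M (x - (+ 7 + + 4 * + k)) (+ 8) rowSum)
          (cong (_* det n M) (eigenvalue x (+ k) (+ n))))
  where
  M : Mat n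
  M a b = x * δ a b - (+ 7 * δ a b + + 4 * adjMat G a b)
  shift : ∀ x d e → x * d - (+ 3 * d - + 3) + (+ 5 - + 4 * (d + e)) ≡ x * d - (+ 7 * d + + 4 * e) + + 8
  shift = solve-∀
  rowSum : ∀ a → sumℤ n (M a) ≡ x - (+ 7 + + 4 * + k)
  rowSum a = trans (sumℤ-cong n (λ b → regroup x (δ a b) (adjMat G a b)))
                   (trans (rowSum-δ-adjMat G k regular (x - + 7) (- + 4) a) (collect x (+ k)))
    where regroup : ∀ x d e → x * d - (+ 7 * d + + 4 * e) ≡ (x - + 7) * d + - + 4 * e
          regroup = solve-∀
          collect : ∀ x k → x - + 7 + - + 4 * k ≡ x - (+ 7 + + 4 * k)
          collect = solve-∀
  eigenvalue : ∀ x k n → x - (+ 7 + + 4 * k) + + 8 * n ≡ x - (- (+ 8 * n) + + 4 * k + + 7)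
  eigenvalue = solve-∀

charPoly-differenceBlock : ∀ {n} (G : Graph n) k → Regular G k → ∀ x →
  det n (λ a b → sameSideBlock x a b - crossBlock G a b) * (x - (- + 1 - + 4 * + k))
    ≡ (x - (+ 2 * + n - + 4 * + k - + 1)) * charPoly (λ a b → - δ a b - + 4 * adjMat G a b) x
charPoly-differenceBlock {n} G k regular x =
  trans (cong (_* (x - (- + 1 - + 4 * + k))) (det-cong n (λ a b → shift x (δ a b) (adjMat G a b))))
   (trans (det-addConstant n M (x - (- + 1 - + 4 * + k)) (- + 2) rowSum)
          (cong (_* det n M) (eigenvalue x (+ k) (+ n))))
  where
  M : Mat n
  M a b = x * δ a b - (- δ a b - + 4 * adjMat G a b)
  shift : ∀ x d e → x * d - (+ 3 * d - + 3) - (+ 5 - + 4 * (d + e)) ≡ x * d - (- d - + 4 * e) + - + 2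
  shift = solve-∀
  rowSum : ∀ a → sumℤ n (M a) ≡ x - (- + 1 - + 4 * + k)
  rowSum a = trans (sumℤ-cong n (λ b → regroup x (δ a b) (adjMat G a b)))
                   (trans (rowSum-δ-adjMat G k regular (x + + 1) (+ 4) a) (collect x (+ k)))
    where regroup : ∀ x d e → x * d - (- d - + 4 * e) ≡ (x + + 1) * d + + 4 * e
          regroup = solve-∀
          collect : ∀ x k → x + + 1 + + 4 * k ≡ x - (- + 1 - + 4 * k)
          collect = solve-∀
  eigenvalue : ∀ x k n → x - (- + 1 - + 4 * k) + - + 2 * n ≡ x - (+ 2 * n - + 4 * k - + 1)
  eigenvalue = solve-∀

theorem6p6 : (n k : ℕ) (G : Graph n) → IsSimple G → Connected G → Regular G k → Diameter2 G →
    (x : ℤ) →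
    charPoly (distSeidel (EDC G)) x * ((x - (+ 7 + + 4 * + k)) * (x - (- + 1 - + 4 * + k)))
      ≡ (x - (- (+ 8 * + n) + + 4 * + k + + 7)) * (x - (+ 2 * + n - + 4 * + k - + 1))
        * charPoly (λ (i j : Fin n) → + 7 * δ i j + + 4 * adjMat G i j) x
        * charPoly (λ (i j : Fin n) → - δ i j - + 4 * adjMat G i j) x
theorem6p6 n k G simple connected regular diam₂ x = begin
  charPoly (distSeidel (EDC G)) x * (μ₁ * μ₂)
    ≡⟨ cong (_* (μ₁ * μ₂)) (det-cong (n ℕ.+ n) (charMatrix-EDC G simple connected diam₂ x)) ⟩
  det (n ℕ.+ n) (block P Q Q P) * (μ₁ * μ₂)
    ≡⟨ cong (_* (μ₁ * μ₂)) (det-block-symmetric n P Q) ⟩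
  det n (λ a b → P a b + Q a b) * det n (λ a b → P a b - Q a b) * (μ₁ * μ₂)
    ≡⟨ interchange (det n (λ a b → P a b + Q a b)) (det n (λ a b → P a b - Q a b)) μ₁ μ₂ ⟩
  (det n (λ a b → P a b + Q a b) * μ₁) * (det n (λ a b → P a b - Q a b) * μ₂)
    ≡⟨ cong₂ _*_ (charPoly-sumBlock G k regular x) (charPoly-differenceBlock G k regular x) ⟩
  (λ₁ * χ₁) * (λ₂ * χ₂)
    ≡⟨ interchange′ λ₁ χ₁ λ₂ χ₂ ⟩
  λ₁ * λ₂ * χ₁ * χ₂
    ∎
  where
  open ≡-Reasoning
  μ₁ μ₂ λ₁ λ₂ χ₁ χ₂ : ℤ
  μ₁ = x - (+ 7 + + 4 * + k)
  μ₂ = x - (- + 1 - + 4 * + k)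
  λ₁ = x - (- (+ 8 * + n) + + 4 * + k + + 7)
  λ₂ = x - (+ 2 * + n - + 4 * + k - + 1)
  χ₁ = charPoly (λ i j → + 7 * δ i j + + 4 * adjMat G i j) x
  χ₂ = charPoly (λ i j → - δ i j - + 4 * adjMat G i j) x
  P Q : Mat n
  P = sameSideBlock x
  Q = crossBlock G
  interchange : ∀ a b c d → a * b * (c * d) ≡ (a * c) * (b * d)
  interchange = solve-∀
  interchange′ : ∀ a b c d → (a * b) * (c * d) ≡ a * c * b * d
  interchange′ = solve-∀
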